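{- For non-negative integers $N,i,j$ with $N\ge i,j$ and $\mu\in\{0,1,2\}$: $$[t^iu^j]P_{3N+\mu}(0,t,u,0;q)=q^{\omega(1,i,j)}\big((\delta_{0\mu}+\delta_{1\mu})F_N(i,j;q)+\delta_{2\mu}G_N(i,j;q)\big),$$ $$[s^iv^j]P_{3N+\mu}(s,0,0,v;q)=q^{\omega(2,i,j)}\big(\delta_{0\mu}F_N(i,j;q)+(\delta_{1\mu}+\delta_{2\mu})G_N(i,j;q)\big),$$ $$[s^iu^j]P_{3N+\mu}(s,0,u,0;q)=q^{\pi(1,i,j)}\big(\delta_{0\mu}F_N(i,j;q)+(\delta_{1\mu}+\delta_{2\mu})G_N(i,j;q)\big),$$ $$[t^iv^j]P_{3N+\mu}(0,t,0,v;q)=q^{\pi(2,i,j)}\big((\delta_{0\mu}+\delta_{1\mu})F_N(i,j;q)+\delta_{2\mu}G_N(i,j;q)\big).$$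
   Context: For $M\ge0$, $\mathcal{DS}^3_{M,\infty}$ is the set of partitions into distinct parts with largest part $\le M$ in which for no $l\ge0$ are both $3l+1$ and $3l+2$ parts. For $\pi=(\pi_1>\pi_2>\cdots)$ and $r=1,2$, $o_r(\pi)$ (resp. $e_r(\pi)$) is the number of odd-indexed parts $\pi_1,\pi_3,\dots$ (resp. even-indexed parts $\pi_2,\pi_4,\dots$) that are $\equiv r\pmod3$. $P_M(s,t,u,v;q)=\sum_{\pi\in\mathcal{DS}^3_{M,\infty}}s^{o_1(\pi)}t^{o_2(\pi)}u^{e_1(\pi)}v^{e_2(\pi)}q^{|\pi|}$, $|\pi|$ the sum of parts. $[x^iy^j]p(x,y)$ denotes the coefficient of $x^iy^j$; $\delta$ is the Kronecker delta. For $m\in\{1,2\}$: $\omega(m,i,j)=(3i-m)i+(3j+m)j$ and $\pi(m,i,j)=\omega(m,i,j)+(-1)^mi$. $F_N(i,j;q)=\begin{bmatrix}N\\ i,j,N-i-j\end{bmatrix}_{q^6}(-q^3;q^3)_{N-i-j}$ and $G_N(i,j;q)=\frac{1-q^{3(N+1+i-j)}}{1-q^{6(N+1)}}F_{N+1}(i,j;q)$, where $\begin{bmatrix}N\\ n_1,\dots,n_m\end{bmatrix}_q=\frac{(q;q)_N}{(q;q)_{n_1}\cdots(q;q)_{n_m}}$ (interpreted as $0$ if some index is negative) and $(x;q)_n=\prod_{k=1}^n(1-xq^{k-1})$. -}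

module Defs where

open import Data.Nat as ℕ using (ℕ; zero; suc; _∸_; _≤_; _≟_; _%_)
open import Data.Nat.Divisibility using (_∣?_)
open import Data.Integer as ℤ using (ℤ; +_)
open import Data.List using (List; []; _∷_; _++_; map; length; filterᵇ)
open import Data.Nat.ListAction using (sum)
open import Data.Bool using (Bool; true; false; if_then_else_; _∧_; not; _∨_)
open import Relation.Nullary.Decidable using (⌊_⌋)
open import Relation.Binary.PropositionalEquality using (_≡_)

-- Formal power series in q with integer coefficients: n ↦ [q^n] f

Series : Set
Series = ℕ → ℤ

infix 4 _≋_
_≋_ : Series → Series → Set
f ≋ g = ∀ n → f n ≡ g n

0ₛ : Series
0ₛ _ = + 0

qpow : ℕ → Series
qpow k n = if ⌊ n ≟ k ⌋ then + 1 else + 0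

1ₛ : Series
1ₛ = qpow 0

infixl 6 _+ₛ_ _-ₛ_
infixl 7 _*ₛ_ _·ₛ_
_+ₛ_ : Series → Series → Series
(f +ₛ g) n = f n ℤ.+ g n

-ₛ_ : Series → Series
(-ₛ f) n = ℤ.- f n

_-ₛ_ : Series → Series → Series
f -ₛ g = f +ₛ (-ₛ g)

_·ₛ_ : ℤ → Series → Series
(c ·ₛ f) n = c ℤ.* f n

sumUpTo : (ℕ → ℤ) → ℕ → ℤ
sumUpTo h zero    = h 0
sumUpTo h (suc n) = sumUpTo h n ℤ.+ h (suc n)

_*ₛ_ : Series → Series → Series
(f *ₛ g) n = sumUpTo (λ k → f k ℤ.* g (n ∸ k)) n

_^ₛ_ : Series → ℕ → Series
f ^ₛ zero  = 1ₛ
f ^ₛ suc k = f *ₛ (f ^ₛ k)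

poch : Series → Series → ℕ → Series
poch x b zero    = 1ₛ
poch x b (suc n) = poch x b n *ₛ (1ₛ -ₛ x *ₛ (b ^ₛ n))

-- 1/(1 - q^a) = Σ_{m≥0} q^{a m}   (used only with a ≥ 1)
invOneMinusQpow : ℕ → Series
invOneMinusQpow a n = if ⌊ a ∣? n ⌋ then + 1 else + 0

invPochQ : ℕ → ℕ → Series
invPochQ b zero    = 1ₛ
invPochQ b (suc n) = invPochQ b n *ₛ invOneMinusQpow (b ℕ.* suc n)

qMultinomial3 : ℕ → ℕ → ℕ → ℕ → Series
qMultinomial3 b N i j =
  if ⌊ (i ℕ.+ j) ℕ.≤? N ⌋
  then poch (qpow b) (qpow b) N *ₛ invPochQ b i *ₛ invPochQ b j
         *ₛ invPochQ b (N ∸ i ∸ j)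
  else 0ₛ

F : ℕ → ℕ → ℕ → Series
F N i j = qMultinomial3 6 N i j *ₛ poch (-ₛ qpow 3) (qpow 3) (N ∸ i ∸ j)

-- G_N(i,j;q) = (1 - q^{3(N+1+i-j)}) / (1 - q^{6(N+1)}) · F_{N+1}(i,j;q)
-- (only used with j ≤ N, so N+1+i-j ≥ 1 is computed correctly in ℕ)
G : ℕ → ℕ → ℕ → Series
G N i j = (1ₛ -ₛ qpow (3 ℕ.* (suc N ℕ.+ i ∸ j)))
            *ₛ invOneMinusQpow (6 ℕ.* suc N) *ₛ F (suc N) i j

-- ω(m,i,j) = (3i-m)i + (3j+m)j   (m ∈ {1,2}; always ≥ 0, and 3i² ≥ m i)
ω : ℕ → ℕ → ℕ → ℕ
ω m i j = (3 ℕ.* i ℕ.* i ∸ m ℕ.* i) ℕ.+ (3 ℕ.* j ℕ.* j ℕ.+ m ℕ.* j)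

-- π(m,i,j) = ω(m,i,j) + (-1)^m i   (m ∈ {1,2}; ω(1,i,j) ≥ i)
πe : ℕ → ℕ → ℕ → ℕ
πe 1 i j = ω 1 i j ∸ i
πe m i j = ω m i j ℕ.+ i

δ : ℕ → ℕ → ℤ
δ a b = if ⌊ a ≟ b ⌋ then + 1 else + 0

-- All partitions into distinct parts with largest part ≤ M, each listed
-- once as a strictly decreasing list π₁ > π₂ > ... of parts in {1..M}.
distinctParts : ℕ → List (List ℕ)
distinctParts zero    = [] ∷ []
distinctParts (suc M) = distinctParts M ++ map (suc M ∷_) (distinctParts M)

elemᵇ : ℕ → List ℕ → Bool
elemᵇ x []       = false
elemᵇ x (y ∷ ys) = ⌊ x ≟ y ⌋ ∨ elemᵇ x ys

-- true iff for some l ≥ 0 both 3l+1 and 3l+2 are parts of π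
-- (equivalently some part p ≡ 1 mod 3 has p+1 also a part)
badPair : List ℕ → List ℕ → Bool
badPair π []       = false
badPair π (p ∷ ps) = (⌊ p % 3 ≟ 1 ⌋ ∧ elemᵇ (suc p) π) ∨ badPair π ps

DS3 : ℕ → List (List ℕ)
DS3 M = filterᵇ (λ π → not (badPair π π)) (distinctParts M)

-- number of parts ≡ r (mod 3) among the odd-indexed parts π₁, π₃, ...
-- (oddCount) and among the even-indexed parts π₂, π₄, ... (evenCount)
mutual
  oddCount : ℕ → List ℕ → ℕ
  oddCount r []       = 0
  oddCount r (p ∷ ps) = (if ⌊ p % 3 ≟ r ⌋ then 1 else 0) ℕ.+ evenCount r ps

  evenCount : ℕ → List ℕ → ℕ
  evenCount r []       = 0
  evenCount r (p ∷ ps) = oddCount r ps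

o : ℕ → List ℕ → ℕ
o = oddCount

e : ℕ → List ℕ → ℕ
e = evenCount

-- [s^a t^b u^c v^d q^n] P_M(s,t,u,v;q):
-- the number of π ∈ DS^3_{M,∞} with o₁ = a, o₂ = b, e₁ = c, e₂ = d, |π| = n
PCoeff : ℕ → ℕ → ℕ → ℕ → ℕ → Series
PCoeff M a b c d n =
  + length (filterᵇ (λ π → ⌊ o 1 π ≟ a ⌋ ∧ ⌊ o 2 π ≟ b ⌋ ∧ ⌊ e 1 π ≟ c ⌋
                           ∧ ⌊ e 2 π ≟ d ⌋ ∧ ⌊ sum π ≟ n ⌋)
                (DS3 M))

module Submission where

open import Defs
open import Data.Nat using (ℕ; _≤_; _+_; _*_)
open import Data.Integer using () renaming (_+_ to _+ℤ_)
open import Data.Product using (_×_)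

open import Algebra.Bundles using (CommutativeRing)
import Algebra.Properties.CommutativeSemigroup as CommutativeSemigroupProperties
import Algebra.Solver.Ring
open import Algebra.Solver.Ring.AlmostCommutativeRing using (fromCommutativeRing; _-Raw-AlmostCommutative⟶_)
open import Data.Nat as ℕ using (zero; suc; _∸_; _<_; z≤n; s≤s; _≤?_; _%_)
import Data.Nat.Properties as ℕₚ
open import Data.Nat.Divisibility using (_∣_; _∣?_; _∣0; ∣-refl; ∣m+n∣m⇒∣n; ∣m∣n⇒∣m+n; >⇒∤)
open import Data.Integer as ℤ using (ℤ; 0ℤ; 1ℤ)
import Data.Integer.Properties as ℤₚ
open import Data.Bool using (Bool; true; false; if_then_else_; _∧_; _∨_; not)
import Data.Bool.Properties as 𝔹ₚ
open import Data.List using (List; []; _∷_; _++_; map; length; filterᵇ)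
import Data.List.Properties as Listₚ
open import Data.List.Relation.Unary.All as All using (All; []; _∷_)
open import Data.List.Relation.Unary.All.Properties using (++⁺; map⁺)
open import Data.Nat.ListAction using (sum)
import Data.Nat.DivMod as DivMod
open import Data.Maybe using (Maybe; just; nothing)
open import Data.Product using (_,_)
open import Data.Sum using (inj₁; inj₂)
open import Data.Empty using (⊥-elim)
open import Function using (_∘_)
open import Relation.Nullary using (¬_; Dec; yes; no)
open import Relation.Nullary.Decidable using (⌊_⌋; isYes≗does; does-⇔; dec-true; dec-false)
open import Function.Bundles using (mk⇔)
open import Relation.Binary.Structures using (IsEquivalence)
open import Relation.Binary.PropositionalEquality
  using (_≡_; _≢_; refl; sym; trans; cong; cong₂; subst; module ≡-Reasoning)
import Relation.Binary.Reasoning.Setoid as SetoidReasoning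
open import Data.Nat.Tactic.RingSolver using (solve-∀)

-- Removing the largest part of a partition gives recurrences for P_M in M.  Prepending a
-- largest part p to a partition with parts below p multiplies by q^p and swaps odd- and
-- even-indexed parts, so it exchanges the coefficient families [t^i u^j] and [s^i v^j] and
-- maps [s^i u^j] and [t^i v^j] to themselves; a new part p ≡ 2 (mod 3) forbids the part
-- p - 1, so that step recurses to M - 1.  Along one period M = 3k, 3k+1, 3k+2, 3k+3 the
-- closed forms satisfy the same recurrences, by the q-series identities
--   G_k(0,j) = F_k(0,j),   G_k(i+1,j) = F_k(i+1,j) + q^{3(k-i-j)} F_k(j,i),
--   F_{k+1}(i,j) = G_k(i,j) + q^{3(k+1+i-j)} G_k(j,i),
-- which follow from the product formula for F by cancelling q-Pochhammer factors, together
-- with matching identities for the exponents ω and π.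

⌊⌋-true : ∀ {P : Set} (p : Dec P) → P → ⌊ p ⌋ ≡ true
⌊⌋-true p x = trans (isYes≗does p) (dec-true p x)

⌊⌋-false : ∀ {P : Set} (p : Dec P) → ¬ P → ⌊ p ⌋ ≡ false
⌊⌋-false p ¬x = trans (isYes≗does p) (dec-false p ¬x)

⌊⌋-⇔ : ∀ {P Q : Set} (p : Dec P) (q : Dec Q) → (P → Q) → (Q → P) → ⌊ p ⌋ ≡ ⌊ q ⌋
⌊⌋-⇔ p q to from = trans (isYes≗does p) (trans (does-⇔ (mk⇔ to from) p q) (sym (isYes≗does q)))

if-yes : ∀ {P : Set} {A : Set} (d : Dec P) {x y : A} → P → (if ⌊ d ⌋ then x else y) ≡ x
if-yes d {x} {y} p = cong (λ b → if b then x else y) (⌊⌋-true d p)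

if-no : ∀ {P : Set} {A : Set} (d : Dec P) {x y : A} → ¬ P → (if ⌊ d ⌋ then x else y) ≡ y
if-no d {x} {y} ¬p = cong (λ b → if b then x else y) (⌊⌋-false d ¬p)

∸-∸-by : ∀ {N} i j n → N ≡ i + j + n → N ∸ i ∸ j ≡ n
∸-∸-by i j n refl =
  trans (cong (λ m → m ∸ i ∸ j) (ℕₚ.+-assoc i j n)) (trans (cong (_∸ j) (ℕₚ.m+n∸m≡n i (j + n))) (ℕₚ.m+n∸m≡n j n))

∸-by : ∀ {a} b c → a ≡ b + c → a ∸ c ≡ b
∸-by b c refl = ℕₚ.m+n∸n≡m b c

∸-excess : ∀ {s} i j n → s ≡ i + j + n → s + i ∸ j ≡ i + i + n
∸-excess i j n s≡i+j+n = ∸-by (i + i + n) j (trans (cong (_+ i) s≡i+j+n) (shuffle i j n))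
  where
  shuffle : ∀ i j n → i + j + n + i ≡ i + i + n + j
  shuffle = solve-∀

-- Finite sums

sumUpTo-cong : ∀ {f g : ℕ → ℤ} n → (∀ k → k ≤ n → f k ≡ g k) → sumUpTo f n ≡ sumUpTo g n
sumUpTo-cong zero    f≗g = f≗g 0 z≤n
sumUpTo-cong (suc n) f≗g =
  cong₂ ℤ._+_ (sumUpTo-cong n (λ k k≤n → f≗g k (ℕₚ.m≤n⇒m≤1+n k≤n))) (f≗g (suc n) ℕₚ.≤-refl)

sumUpTo-+ : ∀ (f g : ℕ → ℤ) n → sumUpTo (λ k → f k +ℤ g k) n ≡ sumUpTo f n +ℤ sumUpTo g n
sumUpTo-+ f g zero    = refl
sumUpTo-+ f g (suc n) = trans (cong (_+ℤ (f (suc n) +ℤ g (suc n))) (sumUpTo-+ f g n))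
  (interchange (sumUpTo f n) (sumUpTo g n) (f (suc n)) (g (suc n)))
  where open CommutativeSemigroupProperties ℤₚ.+-commutativeSemigroup using (interchange)

sumUpTo-*ˡ : ∀ c (f : ℕ → ℤ) n → c ℤ.* sumUpTo f n ≡ sumUpTo (λ k → c ℤ.* f k) n
sumUpTo-*ˡ c f zero    = refl
sumUpTo-*ˡ c f (suc n) =
  trans (ℤₚ.*-distribˡ-+ c (sumUpTo f n) (f (suc n))) (cong (ℤ._+ c ℤ.* f (suc n)) (sumUpTo-*ˡ c f n))

sumUpTo-*ʳ : ∀ c (f : ℕ → ℤ) n → sumUpTo f n ℤ.* c ≡ sumUpTo (λ k → f k ℤ.* c) n
sumUpTo-*ʳ c f n =
  trans (ℤₚ.*-comm _ c) (trans (sumUpTo-*ˡ c f n) (sumUpTo-cong n (λ k _ → ℤₚ.*-comm c (f k))))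

sumUpTo-unfoldˡ : ∀ (f : ℕ → ℤ) n → sumUpTo f (suc n) ≡ f 0 +ℤ sumUpTo (f ∘ suc) n
sumUpTo-unfoldˡ f zero    = refl
sumUpTo-unfoldˡ f (suc n) =
  trans (cong (ℤ._+ f (2 + n)) (sumUpTo-unfoldˡ f n)) (ℤₚ.+-assoc (f 0) _ _)

sumUpTo-reverse : ∀ (f : ℕ → ℤ) n → sumUpTo f n ≡ sumUpTo (λ k → f (n ∸ k)) n
sumUpTo-reverse f zero    = refl
sumUpTo-reverse f (suc n) = begin
  sumUpTo f n +ℤ f (suc n)                  ≡⟨ cong (_+ℤ f (suc n)) (sumUpTo-reverse f n) ⟩
  sumUpTo (λ k → f (n ∸ k)) n +ℤ f (suc n)  ≡⟨ ℤₚ.+-comm _ (f (suc n)) ⟩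
  f (suc n) +ℤ sumUpTo (λ k → f (n ∸ k)) n  ≡⟨ sumUpTo-unfoldˡ (λ k → f (suc n ∸ k)) n ⟨
  sumUpTo (λ k → f (suc n ∸ k)) (suc n)     ∎
  where open ≡-Reasoning

-- Both sides sum U k l over k + l ≤ n.
sumUpTo-triangle : ∀ (U : ℕ → ℕ → ℤ) n →
  sumUpTo (λ k → sumUpTo (U k) (n ∸ k)) n ≡ sumUpTo (λ m → sumUpTo (λ k → U k (m ∸ k)) m) n
sumUpTo-triangle U zero    = refl
sumUpTo-triangle U (suc n) = begin
  sumUpTo (λ k → sumUpTo (U k) (suc n ∸ k)) n +ℤ sumUpTo (U (suc n)) (n ∸ n)
    ≡⟨ cong₂ _+ℤ_ (sumUpTo-cong n lastRow) (cong (sumUpTo (U (suc n))) (ℕₚ.n∸n≡0 n)) ⟩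
  sumUpTo (λ k → sumUpTo (U k) (n ∸ k) +ℤ U k (suc n ∸ k)) n +ℤ U (suc n) 0
    ≡⟨ cong (_+ℤ U (suc n) 0) (sumUpTo-+ _ _ n) ⟩
  (inner n +ℤ diagonal) +ℤ U (suc n) 0
    ≡⟨ ℤₚ.+-assoc (inner n) diagonal (U (suc n) 0) ⟩
  inner n +ℤ (diagonal +ℤ U (suc n) 0)
    ≡⟨ cong₂ _+ℤ_ (sumUpTo-triangle U n) (cong (λ z → diagonal +ℤ U (suc n) z) (sym (ℕₚ.n∸n≡0 n))) ⟩
  sumUpTo (λ m → sumUpTo (λ k → U k (m ∸ k)) m) n +ℤ sumUpTo (λ k → U k (suc n ∸ k)) (suc n) ∎
  where
  open ≡-Reasoning
  inner : ℕ → ℤ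
  inner n = sumUpTo (λ k → sumUpTo (U k) (n ∸ k)) n
  diagonal : ℤ
  diagonal = sumUpTo (λ k → U k (suc n ∸ k)) n
  lastRow : ∀ k → k ≤ n → sumUpTo (U k) (suc n ∸ k) ≡ sumUpTo (U k) (n ∸ k) +ℤ U k (suc n ∸ k)
  lastRow k k≤n rewrite ℕₚ.+-∸-assoc 1 k≤n = refl

-- Formal power series

≋-isEquivalence : IsEquivalence _≋_
≋-isEquivalence = record
  { refl  = λ _ → refl
  ; sym   = λ f≋g n → sym (f≋g n)
  ; trans = λ f≋g g≋h n → trans (f≋g n) (g≋h n)
  }

open IsEquivalence ≋-isEquivalence public
  using () renaming (refl to ≋-refl; sym to ≋-sym; trans to ≋-trans)

+ₛ-cong : ∀ {f f′ g g′} → f ≋ f′ → g ≋ g′ → f +ₛ g ≋ f′ +ₛ g′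
+ₛ-cong f≋f′ g≋g′ n = cong₂ ℤ._+_ (f≋f′ n) (g≋g′ n)

-ₛ-cong : ∀ {f f′} → f ≋ f′ → -ₛ f ≋ -ₛ f′
-ₛ-cong f≋f′ n = cong ℤ.-_ (f≋f′ n)

*ₛ-cong : ∀ {f f′ g g′} → f ≋ f′ → g ≋ g′ → f *ₛ g ≋ f′ *ₛ g′
*ₛ-cong f≋f′ g≋g′ n = sumUpTo-cong n (λ k _ → cong₂ ℤ._*_ (f≋f′ k) (g≋g′ (n ∸ k)))

+ₛ-congˡ : ∀ h {f g} → f ≋ g → h +ₛ f ≋ h +ₛ g
+ₛ-congˡ h = +ₛ-cong (≋-refl {h})

1-ₛ-cong : ∀ {f g} → f ≋ g → 1ₛ -ₛ f ≋ 1ₛ -ₛ g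
1-ₛ-cong f≋g = +ₛ-congˡ 1ₛ (-ₛ-cong f≋g)

*ₛ-congˡ : ∀ h {f g} → f ≋ g → h *ₛ f ≋ h *ₛ g
*ₛ-congˡ h = *ₛ-cong (≋-refl {h})

*ₛ-congʳ : ∀ h {f g} → f ≋ g → f *ₛ h ≋ g *ₛ h
*ₛ-congʳ h f≋g = *ₛ-cong f≋g (≋-refl {h})

qpow-≡ : ∀ a → qpow a a ≡ 1ℤ
qpow-≡ a = if-yes (a ℕ.≟ a) refl

qpow-≢ : ∀ {a k} → ¬ k ≡ a → qpow a k ≡ 0ℤ
qpow-≢ {a} {k} k≢a = if-no (k ℕ.≟ a) k≢a

sumUpTo-qpow : ∀ a (x : ℕ → ℤ) n →
  sumUpTo (λ k → qpow a k ℤ.* x k) n ≡ (if ⌊ a ≤? n ⌋ then x a else 0ℤ)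
sumUpTo-qpow zero    x zero    = ℤₚ.*-identityˡ (x 0)
sumUpTo-qpow (suc a) x zero    = refl
sumUpTo-qpow a x (suc n) with a ≤? n | a ≤? suc n | sumUpTo-qpow a x n
... | yes a≤n | yes _    | ih rewrite ih | qpow-≢ {a} (λ e → ℕₚ.<-irrefl (sym e) (s≤s a≤n)) =
  ℤₚ.+-identityʳ (x a)
... | yes a≤n | no a≰1+n | _  = ⊥-elim (a≰1+n (ℕₚ.m≤n⇒m≤1+n a≤n))
... | no a≰n  | no a≰1+n | ih rewrite ih | qpow-≢ {a} (λ e → a≰1+n (ℕₚ.≤-reflexive (sym e))) =
  refl
... | no a≰n  | yes a≤1+n | ih rewrite ih with ℕₚ.m≤n⇒m<n∨m≡n a≤1+n
...   | inj₁ (s≤s a≤n) = ⊥-elim (a≰n a≤n)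
...   | inj₂ refl rewrite qpow-≡ (suc n) =
  trans (ℤₚ.+-identityˡ _) (ℤₚ.*-identityˡ (x (suc n)))

qpow-*ₛ : ∀ a f n → (qpow a *ₛ f) n ≡ (if ⌊ a ≤? n ⌋ then f (n ∸ a) else 0ℤ)
qpow-*ₛ a f n = sumUpTo-qpow a (λ k → f (n ∸ k)) n

*ₛ-identityˡ : ∀ f → 1ₛ *ₛ f ≋ f
*ₛ-identityˡ f = qpow-*ₛ 0 f

*ₛ-comm : ∀ f g → f *ₛ g ≋ g *ₛ f
*ₛ-comm f g n = begin
  sumUpTo (λ k → f k ℤ.* g (n ∸ k)) n               ≡⟨ sumUpTo-reverse _ n ⟩
  sumUpTo (λ k → f (n ∸ k) ℤ.* g (n ∸ (n ∸ k))) n   ≡⟨ sumUpTo-cong n swap ⟩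
  sumUpTo (λ k → g k ℤ.* f (n ∸ k)) n               ∎
  where
  open ≡-Reasoning
  swap : ∀ k → k ≤ n → f (n ∸ k) ℤ.* g (n ∸ (n ∸ k)) ≡ g k ℤ.* f (n ∸ k)
  swap k k≤n rewrite ℕₚ.m∸[m∸n]≡n k≤n = ℤₚ.*-comm (f (n ∸ k)) (g k)

*ₛ-distribˡ : ∀ f g h → f *ₛ (g +ₛ h) ≋ f *ₛ g +ₛ f *ₛ h
*ₛ-distribˡ f g h n =
  trans (sumUpTo-cong n (λ k _ → ℤₚ.*-distribˡ-+ (f k) (g (n ∸ k)) (h (n ∸ k)))) (sumUpTo-+ _ _ n)

*ₛ-assoc : ∀ f g h → (f *ₛ g) *ₛ h ≋ f *ₛ (g *ₛ h)
*ₛ-assoc f g h n = begin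
  sumUpTo (λ m → sumUpTo (λ k → f k ℤ.* g (m ∸ k)) m ℤ.* h (n ∸ m)) n
    ≡⟨ sumUpTo-cong n (λ m _ → sumUpTo-*ʳ (h (n ∸ m)) _ m) ⟩
  sumUpTo (λ m → sumUpTo (λ k → f k ℤ.* g (m ∸ k) ℤ.* h (n ∸ m)) m) n
    ≡⟨ sumUpTo-cong n (λ m m≤n → sumUpTo-cong m (λ k k≤m →
         cong (λ z → f k ℤ.* g (m ∸ k) ℤ.* h z) (rest k m k≤m m≤n))) ⟩
  sumUpTo (λ m → sumUpTo (λ k → f k ℤ.* g (m ∸ k) ℤ.* h (n ∸ k ∸ (m ∸ k))) m) n
    ≡⟨ sumUpTo-triangle (λ k l → f k ℤ.* g l ℤ.* h (n ∸ k ∸ l)) n ⟨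
  sumUpTo (λ k → sumUpTo (λ l → f k ℤ.* g l ℤ.* h (n ∸ k ∸ l)) (n ∸ k)) n
    ≡⟨ sumUpTo-cong n (λ k _ → trans (sumUpTo-cong (n ∸ k) (λ l _ → ℤₚ.*-assoc (f k) _ _))
                                      (sym (sumUpTo-*ˡ (f k) _ (n ∸ k)))) ⟩
  sumUpTo (λ k → f k ℤ.* sumUpTo (λ l → g l ℤ.* h (n ∸ k ∸ l)) (n ∸ k)) n ∎
  where
  open ≡-Reasoning
  rest : ∀ k m → k ≤ m → m ≤ n → n ∸ m ≡ n ∸ k ∸ (m ∸ k)
  rest k m k≤m m≤n = sym (trans (ℕₚ.∸-+-assoc n k (m ∸ k)) (cong (n ∸_) (ℕₚ.m+[n∸m]≡n k≤m)))

seriesRing : CommutativeRing _ _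
seriesRing = record
  { Carrier = Series ; _≈_ = _≋_ ; _+_ = _+ₛ_ ; _*_ = _*ₛ_ ; -_ = -ₛ_ ; 0# = 0ₛ ; 1# = 1ₛ
  ; isCommutativeRing = record
    { isRing = record
      { +-isAbelianGroup = record
        { isGroup = record
          { isMonoid = record
            { isSemigroup = record
              { isMagma = record { isEquivalence = ≋-isEquivalence ; ∙-cong = +ₛ-cong }
              ; assoc = λ f g h n → ℤₚ.+-assoc (f n) (g n) (h n) }
            ; identity = (λ f n → ℤₚ.+-identityˡ (f n)) , (λ f n → ℤₚ.+-identityʳ (f n)) }
          ; inverse = (λ f n → ℤₚ.+-inverseˡ (f n)) , (λ f n → ℤₚ.+-inverseʳ (f n))
          ; ⁻¹-cong = -ₛ-cong }
        ; comm = λ f g n → ℤₚ.+-comm (f n) (g n) }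
      ; *-cong = *ₛ-cong
      ; *-assoc = *ₛ-assoc
      ; *-identity = *ₛ-identityˡ , (λ f → ≋-trans (*ₛ-comm f 1ₛ) (*ₛ-identityˡ f))
      ; distrib = *ₛ-distribˡ , λ f g h → ≋-trans (*ₛ-comm (g +ₛ h) f)
                    (≋-trans (*ₛ-distribˡ f g h) (+ₛ-cong (*ₛ-comm f g) (*ₛ-comm f h)))
      }
    ; *-comm = *ₛ-comm } }

module ≋-Reasoning = SetoidReasoning (CommutativeRing.setoid seriesRing)

*ₛ-vanishesʳ : ∀ h {f} → f ≋ 0ₛ → h *ₛ f ≋ 0ₛ
*ₛ-vanishesʳ h f≋0 = ≋-trans (*ₛ-congˡ h f≋0) (CommutativeRing.zeroʳ seriesRing h)

-- The literals 0 and 1 are mapped to 0ₛ and 1ₛ themselves, so that the solver's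
-- `con 0ℤ` and `con 1ℤ` are definitionally the series occurring in goals.
constant : ℤ → Series
constant (ℤ.+ 0) = 0ₛ
constant (ℤ.+ 1) = 1ₛ
constant c       = c ·ₛ 1ₛ

constant-≋ : ∀ c → constant c ≋ c ·ₛ 1ₛ
constant-≋ (ℤ.+ 0)             n = sym (ℤₚ.*-zeroˡ (1ₛ n))
constant-≋ (ℤ.+ 1)             n = sym (ℤₚ.*-identityˡ (1ₛ n))
constant-≋ (ℤ.+ suc (suc m))   n = refl
constant-≋ (ℤ.-[1+ m ])        n = refl

·ₛ-as-*ₛ : ∀ c f → (c ·ₛ 1ₛ) *ₛ f ≋ c ·ₛ f
·ₛ-as-*ₛ c f n = begin
  sumUpTo (λ k → (c ℤ.* 1ₛ k) ℤ.* f (n ∸ k)) n  ≡⟨ sumUpTo-cong n (λ k _ → ℤₚ.*-assoc c (1ₛ k) (f (n ∸ k))) ⟩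
  sumUpTo (λ k → c ℤ.* (1ₛ k ℤ.* f (n ∸ k))) n  ≡⟨ sumUpTo-*ˡ c _ n ⟨
  c ℤ.* (1ₛ *ₛ f) n                            ≡⟨ cong (c ℤ.*_) (*ₛ-identityˡ f n) ⟩
  c ℤ.* f n                                    ∎
  where open ≡-Reasoning

constant-morphism : CommutativeRing.rawRing ℤₚ.+-*-commutativeRing
                      -Raw-AlmostCommutative⟶ fromCommutativeRing seriesRing
constant-morphism = record
  { ⟦_⟧    = constant
  ; +-homo = λ a b n → trans (constant-≋ (a ℤ.+ b) n)
               (trans (ℤₚ.*-distribʳ-+ (1ₛ n) a b) (sym (cong₂ ℤ._+_ (constant-≋ a n) (constant-≋ b n))))
  ; *-homo = λ a b n → trans (constant-≋ (a ℤ.* b) n)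
               (trans (trans (ℤₚ.*-assoc a b (1ₛ n)) (sym (·ₛ-as-*ₛ a (b ·ₛ 1ₛ) n)))
                      (sym (*ₛ-cong (constant-≋ a) (constant-≋ b) n)))
  ; -‿homo = λ a n → trans (constant-≋ (ℤ.- a) n)
               (trans (sym (ℤₚ.neg-distribˡ-* a (1ₛ n))) (cong ℤ.-_ (sym (constant-≋ a n))))
  ; 0-homo = λ _ → refl
  ; 1-homo = λ _ → refl
  }

constant-≟ : ∀ a b → Maybe (constant a ≋ constant b)
constant-≟ a b with a ℤ.≟ b
... | yes refl = just ≋-refl
... | no _     = nothing

open Algebra.Solver.Ring (CommutativeRing.rawRing ℤₚ.+-*-commutativeRing)
  (fromCommutativeRing seriesRing) constant-morphism constant-≟
  using (solve; _:=_; _:+_; _:*_; :-_; _:-_; con)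

qpow-cong : ∀ {a b} → a ≡ b → qpow a ≋ qpow b
qpow-cong refl = ≋-refl

qpow-+ : ∀ a b → qpow a *ₛ qpow b ≋ qpow (a + b)
qpow-+ a b n rewrite qpow-*ₛ a (qpow b) n with a ≤? n
... | no a≰n = sym (qpow-≢ (λ n≡a+b → a≰n (ℕₚ.≤-trans (ℕₚ.m≤m+n a b) (ℕₚ.≤-reflexive (sym n≡a+b)))))
... | yes a≤n with n ℕ.≟ a + b
...   | yes n≡a+b rewrite n≡a+b | ℕₚ.m+n∸m≡n a b = qpow-≡ b
...   | no n≢a+b  = qpow-≢ (λ n∸a≡b → n≢a+b (trans (sym (ℕₚ.m+[n∸m]≡n a≤n)) (cong (λ z → a + z) n∸a≡b)))

qpow-^ : ∀ c m → qpow c ^ₛ m ≋ qpow (c * m)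
qpow-^ c zero    = qpow-cong (sym (ℕₚ.*-zeroʳ c))
qpow-^ c (suc m) = ≋-trans (*ₛ-congˡ (qpow c) (qpow-^ c m))
                     (≋-trans (qpow-+ c (c * m)) (qpow-cong (sym (ℕₚ.*-suc c m))))

geometric-unfold : ∀ a → 1 ≤ a → invOneMinusQpow a ≋ 1ₛ +ₛ qpow a *ₛ invOneMinusQpow a
geometric-unfold a 1≤a n rewrite qpow-*ₛ a (invOneMinusQpow a) n with a ≤? n
geometric-unfold a 1≤a zero    | yes a≤0 = ⊥-elim (ℕₚ.<-irrefl refl (ℕₚ.≤-trans 1≤a a≤0))
geometric-unfold a 1≤a (suc n) | yes a≤n =
  trans (cong (λ b → if b then 1ℤ else 0ℤ) (⌊⌋-⇔ (a ∣? suc n) (a ∣? (suc n ∸ a))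
           (λ a∣1+n → ∣m+n∣m⇒∣n (subst (a ∣_) 1+n≡a+r a∣1+n) ∣-refl)
           (λ a∣r → subst (a ∣_) (sym 1+n≡a+r) (∣m∣n⇒∣m+n ∣-refl a∣r))))
        (sym (ℤₚ.+-identityˡ _))
  where
  1+n≡a+r : suc n ≡ a + (suc n ∸ a)
  1+n≡a+r = sym (ℕₚ.m+[n∸m]≡n a≤n)
geometric-unfold a 1≤a zero    | no _ = if-yes (a ∣? 0) (a ∣0)
geometric-unfold (suc a) 1≤a (suc n) | no a≰n =
  trans (if-no (suc a ∣? suc n) (>⇒∤ (ℕₚ.≰⇒> a≰n))) (sym (ℤₚ.+-identityʳ 0ℤ))

geometric-inverse : ∀ a → 1 ≤ a → invOneMinusQpow a *ₛ (1ₛ -ₛ qpow a) ≋ 1ₛ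
geometric-inverse a 1≤a = begin
  I *ₛ (1ₛ -ₛ x)              ≈⟨ solve 2 (λ I x → I :* (con 1ℤ :- x) := I :- x :* I) ≋-refl I x ⟩
  I -ₛ x *ₛ I                 ≈⟨ +ₛ-cong (geometric-unfold a 1≤a) ≋-refl ⟩
  (1ₛ +ₛ x *ₛ I) -ₛ x *ₛ I    ≈⟨ solve 2 (λ I x → (con 1ℤ :+ x :* I) :- x :* I := con 1ℤ) ≋-refl I x ⟩
  1ₛ                          ∎
  where
  open ≋-Reasoning
  I = invOneMinusQpow a
  x = qpow a

-- The series F and G

poch6 : ℕ → Series
poch6 = poch (qpow 6) (qpow 6)

negPoch3 : ℕ → Series
negPoch3 = poch (-ₛ qpow 3) (qpow 3)

inv6 : ℕ → Series
inv6 m = invOneMinusQpow (6 * m)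

poch6-suc : ∀ k → poch6 (suc k) ≋ poch6 k *ₛ (1ₛ -ₛ qpow (6 * suc k))
poch6-suc k = *ₛ-congˡ (poch6 k) (1-ₛ-cong
  (≋-trans (*ₛ-congˡ (qpow 6) (qpow-^ 6 k)) (≋-trans (qpow-+ 6 (6 * k)) (qpow-cong (sym (ℕₚ.*-suc 6 k))))))

negPoch3-suc : ∀ m → negPoch3 (suc m) ≋ negPoch3 m *ₛ (1ₛ +ₛ qpow (3 * suc m))
negPoch3-suc m = *ₛ-congˡ (negPoch3 m) (begin
  1ₛ -ₛ (-ₛ qpow 3) *ₛ (qpow 3 ^ₛ m)
    ≈⟨ solve 2 (λ a b → con 1ℤ :- (:- a) :* b := con 1ℤ :+ a :* b) ≋-refl (qpow 3) (qpow 3 ^ₛ m) ⟩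
  1ₛ +ₛ qpow 3 *ₛ (qpow 3 ^ₛ m)
    ≈⟨ +ₛ-congˡ 1ₛ (≋-trans (*ₛ-congˡ (qpow 3) (qpow-^ 3 m))
                      (≋-trans (qpow-+ 3 (3 * m)) (qpow-cong (sym (ℕₚ.*-suc 3 m))))) ⟩
  1ₛ +ₛ qpow (3 * suc m) ∎)
  where open ≋-Reasoning

inv6-inverse : ∀ m → inv6 (suc m) *ₛ (1ₛ -ₛ qpow (6 * suc m)) ≋ 1ₛ
inv6-inverse m = geometric-inverse (6 * suc m) (s≤s z≤n)

-- 1 - q^{6(m+1)} = (1 - q^{3(m+1)})(1 + q^{3(m+1)}), the second factor coming from (-q^3;q^3).
inv6-inverse-square : ∀ m → inv6 (suc m) *ₛ (1ₛ -ₛ qpow (3 * suc m) *ₛ qpow (3 * suc m)) ≋ 1ₛ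
inv6-inverse-square m = ≋-trans
  (*ₛ-congˡ (inv6 (suc m)) (1-ₛ-cong
    (≋-trans (qpow-+ (3 * suc m) (3 * suc m)) (qpow-cong (6*m≡3*m+3*m (suc m))))))
  (inv6-inverse m)
  where
  6*m≡3*m+3*m : ∀ m → 3 * m + 3 * m ≡ 6 * m
  6*m≡3*m+3*m = solve-∀

multinomialForm : ℕ → ℕ → ℕ → ℕ → Series
multinomialForm N i j n =
  poch6 N *ₛ invPochQ 6 i *ₛ invPochQ 6 j *ₛ invPochQ 6 n *ₛ negPoch3 n

F-closedForm : ∀ {N} i j n → N ≡ i + j + n → F N i j ≋ multinomialForm N i j n
F-closedForm i j n refl
  rewrite ∸-∸-by i j n refl
        | if-yes ((i + j) ℕ.≤? (i + j + n)) {x = poch6 (i + j + n) *ₛ invPochQ 6 i *ₛ invPochQ 6 j *ₛ invPochQ 6 n}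
                 {y = 0ₛ} (ℕₚ.m≤m+n (i + j) n)
  = ≋-refl

F-vanishes : ∀ {N} i j → N < i + j → F N i j ≋ 0ₛ
F-vanishes {N} i j N<i+j
  rewrite if-no ((i + j) ℕ.≤? N) {x = poch6 N *ₛ invPochQ 6 i *ₛ invPochQ 6 j *ₛ invPochQ 6 (N ∸ i ∸ j)}
                {y = 0ₛ} (ℕₚ.<⇒≱ N<i+j)
  = CommutativeRing.zeroˡ seriesRing (negPoch3 (N ∸ i ∸ j))

data Support (N i j : ℕ) : Set where
  inside  : ∀ n → N ≡ i + j + n → Support N i j
  outside : N < i + j → Support N i j

support : ∀ N i j → Support N i j
support N i j with ℕₚ.≤-<-connex (i + j) N
... | inj₁ i+j≤N = inside (N ∸ (i + j)) (sym (ℕₚ.m+[n∸m]≡n i+j≤N))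
... | inj₂ N<i+j = outside N<i+j

*ₛF-cong : ∀ {A B} N i j → (∀ n → N ≡ i + j + n → A ≋ B) → A *ₛ F N i j ≋ B *ₛ F N i j
*ₛF-cong {A} {B} N i j A≋B with support N i j
... | inside n N≡i+j+n = *ₛ-congʳ (F N i j) (A≋B n N≡i+j+n)
... | outside N<i+j =
  ≋-trans (*ₛ-vanishesʳ A (F-vanishes i j N<i+j)) (≋-sym (*ₛ-vanishesʳ B (F-vanishes i j N<i+j)))

F-comm : ∀ N i j → F N i j ≋ F N j i
F-comm N i j with support N i j
... | outside N<i+j = ≋-trans (F-vanishes i j N<i+j) (≋-sym (F-vanishes j i (subst (N <_) (ℕₚ.+-comm i j) N<i+j)))
... | inside n N≡i+j+n = begin
  F N i j                                                         ≈⟨ F-closedForm i j n N≡i+j+n ⟩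
  poch6 N *ₛ invPochQ 6 i *ₛ invPochQ 6 j *ₛ invPochQ 6 n *ₛ negPoch3 n
    ≈⟨ solve 5 (λ p a b c r → p :* a :* b :* c :* r := p :* b :* a :* c :* r) ≋-refl
         (poch6 N) (invPochQ 6 i) (invPochQ 6 j) (invPochQ 6 n) (negPoch3 n) ⟩
  poch6 N *ₛ invPochQ 6 j *ₛ invPochQ 6 i *ₛ invPochQ 6 n *ₛ negPoch3 n
    ≈⟨ F-closedForm j i n (trans N≡i+j+n (cong (_+ n) (ℕₚ.+-comm i j))) ⟨
  F N j i                                                         ∎
  where open ≋-Reasoning

multinomialForm-suc : ∀ N i j n → multinomialForm (suc N) i j n ≋ (1ₛ -ₛ qpow (6 * suc N)) *ₛ multinomialForm N i j n
multinomialForm-suc N i j n = begin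
  poch6 (suc N) *ₛ I i *ₛ I j *ₛ I n *ₛ negPoch3 n
    ≈⟨ *ₛ-congʳ (negPoch3 n) (*ₛ-congʳ (I n) (*ₛ-congʳ (I j) (*ₛ-congʳ (I i) (poch6-suc N)))) ⟩
  poch6 N *ₛ (1ₛ -ₛ Q) *ₛ I i *ₛ I j *ₛ I n *ₛ negPoch3 n
    ≈⟨ solve 6 (λ P Q a b c r → P :* (con 1ℤ :- Q) :* a :* b :* c :* r
                              := (con 1ℤ :- Q) :* (P :* a :* b :* c :* r))
         ≋-refl (poch6 N) Q (I i) (I j) (I n) (negPoch3 n) ⟩
  (1ₛ -ₛ Q) *ₛ multinomialForm N i j n ∎
  where
  open ≋-Reasoning
  I = invPochQ 6
  Q = qpow (6 * suc N)

multinomialForm-sucˡ : ∀ N i j n → multinomialForm N (suc i) j n ≋ inv6 (suc i) *ₛ multinomialForm N i j n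
multinomialForm-sucˡ N i j n =
  solve 6 (λ P a A b c r → P :* (a :* A) :* b :* c :* r := A :* (P :* a :* b :* c :* r))
    ≋-refl (poch6 N) (invPochQ 6 i) (inv6 (suc i)) (invPochQ 6 j) (invPochQ 6 n) (negPoch3 n)

multinomialForm-sucʳ : ∀ N i j n →
  multinomialForm N i j (suc n) ≋ inv6 (suc n) *ₛ (1ₛ +ₛ qpow (3 * suc n)) *ₛ multinomialForm N i j n
multinomialForm-sucʳ N i j n = begin
  P *ₛ a *ₛ b *ₛ (c *ₛ B) *ₛ negPoch3 (suc n)        ≈⟨ *ₛ-congˡ (P *ₛ a *ₛ b *ₛ (c *ₛ B)) (negPoch3-suc n) ⟩
  P *ₛ a *ₛ b *ₛ (c *ₛ B) *ₛ (r *ₛ (1ₛ +ₛ y))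
    ≈⟨ solve 7 (λ P a b c B r y → P :* a :* b :* (c :* B) :* (r :* (con 1ℤ :+ y))
                                := B :* (con 1ℤ :+ y) :* (P :* a :* b :* c :* r))
         ≋-refl P a b c B r y ⟩
  B *ₛ (1ₛ +ₛ y) *ₛ multinomialForm N i j n            ∎
  where
  open ≋-Reasoning
  P = poch6 N
  a = invPochQ 6 i
  b = invPochQ 6 j
  c = invPochQ 6 n
  B = inv6 (suc n)
  r = negPoch3 n
  y = qpow (3 * suc n)

F-suc-suc : ∀ k i j → F (suc k) (suc i) j ≋ (1ₛ -ₛ qpow (6 * suc k)) *ₛ inv6 (suc i) *ₛ F k i j
F-suc-suc k i j with support k i j
... | outside k<i+j = ≋-trans (F-vanishes (suc i) j (s≤s k<i+j))
  (≋-sym (*ₛ-vanishesʳ ((1ₛ -ₛ qpow (6 * suc k)) *ₛ inv6 (suc i)) (F-vanishes i j k<i+j)))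
... | inside n k≡i+j+n = begin
  F (suc k) (suc i) j                                ≈⟨ F-closedForm (suc i) j n (cong suc k≡i+j+n) ⟩
  multinomialForm (suc k) (suc i) j n                ≈⟨ multinomialForm-suc k (suc i) j n ⟩
  (1ₛ -ₛ Q) *ₛ multinomialForm k (suc i) j n         ≈⟨ *ₛ-congˡ (1ₛ -ₛ Q) (multinomialForm-sucˡ k i j n) ⟩
  (1ₛ -ₛ Q) *ₛ (A *ₛ multinomialForm k i j n)        ≈⟨ *ₛ-assoc (1ₛ -ₛ Q) A (multinomialForm k i j n) ⟨
  (1ₛ -ₛ Q) *ₛ A *ₛ multinomialForm k i j n          ≈⟨ *ₛ-congˡ ((1ₛ -ₛ Q) *ₛ A) (F-closedForm i j n k≡i+j+n) ⟨
  (1ₛ -ₛ Q) *ₛ A *ₛ F k i j                          ∎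
  where
  open ≋-Reasoning
  Q = qpow (6 * suc k)
  A = inv6 (suc i)

F-sucˡ : ∀ k i j → F k (suc i) j ≋ inv6 (suc i) *ₛ (1ₛ -ₛ qpow (3 * (k ∸ i ∸ j))) *ₛ F k i j
F-sucˡ k i j with support k i j
... | outside k<i+j = ≋-trans (F-vanishes (suc i) j (ℕₚ.m<n⇒m<1+n k<i+j))
  (≋-sym (*ₛ-vanishesʳ (inv6 (suc i) *ₛ (1ₛ -ₛ qpow (3 * (k ∸ i ∸ j)))) (F-vanishes i j k<i+j)))
... | inside zero k≡i+j+0 = begin
  F k (suc i) j           ≈⟨ F-vanishes (suc i) j (subst (_< suc (i + j)) (sym (trans k≡i+j+0 (ℕₚ.+-identityʳ _))) ℕₚ.≤-refl) ⟩
  0ₛ                      ≈⟨ solve 2 (λ A f → con 0ℤ := A :* (con 1ℤ :- con 1ℤ) :* f) ≋-refl (inv6 (suc i)) (F k i j) ⟩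
  A *ₛ (1ₛ -ₛ 1ₛ) *ₛ F k i j
    ≈⟨ *ₛ-congʳ (F k i j) (*ₛ-congˡ A (1-ₛ-cong (qpow-cong (cong (3 *_) (∸-∸-by i j 0 k≡i+j+0))))) ⟨
  A *ₛ (1ₛ -ₛ qpow (3 * (k ∸ i ∸ j))) *ₛ F k i j ∎
  where
  open ≋-Reasoning
  A = inv6 (suc i)
... | inside (suc m) k≡i+j+1+m = begin
  F k (suc i) j                                       ≈⟨ F-closedForm (suc i) j m (trans k≡i+j+1+m (ℕₚ.+-suc (i + j) m)) ⟩
  multinomialForm k (suc i) j m                       ≈⟨ multinomialForm-sucˡ k i j m ⟩
  A *ₛ Φ                                              ≈⟨ *ₛ-congˡ A (*ₛ-identityˡ Φ) ⟨
  A *ₛ (1ₛ *ₛ Φ)                                      ≈⟨ *ₛ-congˡ A (*ₛ-congʳ Φ (inv6-inverse-square m)) ⟨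
  A *ₛ (B *ₛ (1ₛ -ₛ y *ₛ y) *ₛ Φ)
    ≈⟨ solve 4 (λ A B y Φ → A :* (B :* (con 1ℤ :- y :* y) :* Φ) := A :* (con 1ℤ :- y) :* (B :* (con 1ℤ :+ y) :* Φ))
         ≋-refl A B y Φ ⟩
  A *ₛ (1ₛ -ₛ y) *ₛ (B *ₛ (1ₛ +ₛ y) *ₛ Φ)             ≈⟨ *ₛ-congˡ (A *ₛ (1ₛ -ₛ y)) (multinomialForm-sucʳ k i j m) ⟨
  A *ₛ (1ₛ -ₛ y) *ₛ multinomialForm k i j (suc m)     ≈⟨ *ₛ-cong (*ₛ-congˡ A (1-ₛ-cong (qpow-cong (cong (3 *_) (∸-∸-by i j (suc m) k≡i+j+1+m)))))
                                                                 (F-closedForm i j (suc m) k≡i+j+1+m) ⟨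
  A *ₛ (1ₛ -ₛ qpow (3 * (k ∸ i ∸ j))) *ₛ F k i j      ∎
  where
  open ≋-Reasoning
  A = inv6 (suc i)
  B = inv6 (suc m)
  y = qpow (3 * suc m)
  Φ = multinomialForm k i j m

G-zero : ∀ k j → G k 0 j ≋ F k 0 j
G-zero k j with support k 0 j
... | outside k<j = begin
  (1ₛ -ₛ qpow (3 * (suc k + 0 ∸ j))) *ₛ J *ₛ F (suc k) 0 j
    ≈⟨ *ₛ-congʳ (F (suc k) 0 j) (*ₛ-congʳ J (1-ₛ-cong (qpow-cong (cong (3 *_) 1+k∸j≡0)))) ⟩
  (1ₛ -ₛ 1ₛ) *ₛ J *ₛ F (suc k) 0 j
    ≈⟨ solve 2 (λ J f → (con 1ℤ :- con 1ℤ) :* J :* f := con 0ℤ) ≋-refl J (F (suc k) 0 j) ⟩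
  0ₛ
    ≈⟨ F-vanishes 0 j k<j ⟨
  F k 0 j ∎
  where
  open ≋-Reasoning
  J = inv6 (suc k)
  1+k∸j≡0 : suc k + 0 ∸ j ≡ 0
  1+k∸j≡0 = ℕₚ.m≤n⇒m∸n≡0 (subst (_≤ j) (sym (ℕₚ.+-identityʳ (suc k))) k<j)
... | inside n k≡j+n = begin
  (1ₛ -ₛ qpow (3 * (suc k + 0 ∸ j))) *ₛ J *ₛ F (suc k) 0 j
    ≈⟨ *ₛ-cong (*ₛ-congʳ J (1-ₛ-cong (qpow-cong (cong (3 *_) (∸-excess 0 j (suc n) 1+k≡j+1+n)))))
               (F-closedForm 0 j (suc n) 1+k≡j+1+n) ⟩
  (1ₛ -ₛ y) *ₛ J *ₛ multinomialForm (suc k) 0 j (suc n)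
    ≈⟨ *ₛ-congˡ ((1ₛ -ₛ y) *ₛ J) (≋-trans (multinomialForm-suc k 0 j (suc n))
                                    (*ₛ-congˡ (1ₛ -ₛ Q) (multinomialForm-sucʳ k 0 j n))) ⟩
  (1ₛ -ₛ y) *ₛ J *ₛ ((1ₛ -ₛ Q) *ₛ (B *ₛ (1ₛ +ₛ y) *ₛ Φ))
    ≈⟨ solve 5 (λ y J Q B Φ → (con 1ℤ :- y) :* J :* ((con 1ℤ :- Q) :* (B :* (con 1ℤ :+ y) :* Φ))
                            := J :* (con 1ℤ :- Q) :* (B :* (con 1ℤ :- y :* y)) :* Φ) ≋-refl y J Q B Φ ⟩
  J *ₛ (1ₛ -ₛ Q) *ₛ (B *ₛ (1ₛ -ₛ y *ₛ y)) *ₛ Φ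
    ≈⟨ *ₛ-congʳ Φ (*ₛ-cong (inv6-inverse k) (inv6-inverse-square n)) ⟩
  1ₛ *ₛ 1ₛ *ₛ Φ
    ≈⟨ solve 1 (λ Φ → con 1ℤ :* con 1ℤ :* Φ := Φ) ≋-refl Φ ⟩
  Φ
    ≈⟨ F-closedForm 0 j n k≡j+n ⟨
  F k 0 j ∎
  where
  open ≋-Reasoning
  J = inv6 (suc k)
  Q = qpow (6 * suc k)
  B = inv6 (suc n)
  y = qpow (3 * suc n)
  Φ = multinomialForm k 0 j n
  1+k≡j+1+n : suc k ≡ j + suc n
  1+k≡j+1+n = trans (cong suc k≡j+n) (sym (ℕₚ.+-suc j n))

G-suc-exponent : ∀ {k} i j n → k ≡ i + j + n → 3 * (suc k + suc i ∸ j) ≡ 6 * suc i + 3 * (k ∸ i ∸ j)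
G-suc-exponent {k} i j n k≡i+j+n = begin
  3 * (suc k + suc i ∸ j)       ≡⟨ cong (3 *_) (∸-excess (suc i) j n (cong suc k≡i+j+n)) ⟩
  3 * (suc i + suc i + n)       ≡⟨ split i n ⟩
  6 * suc i + 3 * n             ≡⟨ cong (λ m → 6 * suc i + 3 * m) (∸-∸-by i j n k≡i+j+n) ⟨
  6 * suc i + 3 * (k ∸ i ∸ j)   ∎
  where
  open ≡-Reasoning
  split : ∀ i n → 3 * (suc i + suc i + n) ≡ 6 * suc i + 3 * n
  split = solve-∀

G-suc : ∀ k i j → G k (suc i) j ≋ F k (suc i) j +ₛ qpow (3 * (k ∸ i ∸ j)) *ₛ F k j i
G-suc k i j = begin
  (1ₛ -ₛ x) *ₛ J *ₛ F (suc k) (suc i) j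
    ≈⟨ *ₛ-congˡ ((1ₛ -ₛ x) *ₛ J) (F-suc-suc k i j) ⟩
  (1ₛ -ₛ x) *ₛ J *ₛ ((1ₛ -ₛ Q) *ₛ A *ₛ Φ)
    ≈⟨ solve 5 (λ x J Q A Φ → (con 1ℤ :- x) :* J :* ((con 1ℤ :- Q) :* A :* Φ)
                            := J :* (con 1ℤ :- Q) :* ((con 1ℤ :- x) :* A :* Φ)) ≋-refl x J Q A Φ ⟩
  J *ₛ (1ₛ -ₛ Q) *ₛ ((1ₛ -ₛ x) *ₛ A *ₛ Φ)
    ≈⟨ ≋-trans (*ₛ-congʳ ((1ₛ -ₛ x) *ₛ A *ₛ Φ) (inv6-inverse k)) (*ₛ-identityˡ _) ⟩
  (1ₛ -ₛ x) *ₛ A *ₛ Φ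
    ≈⟨ *ₛF-cong k i j (λ n k≡i+j+n → *ₛ-congʳ A (1-ₛ-cong
         (≋-trans (qpow-cong (G-suc-exponent i j n k≡i+j+n)) (≋-sym (qpow-+ (6 * suc i) (3 * (k ∸ i ∸ j))))))) ⟩
  (1ₛ -ₛ z *ₛ y) *ₛ A *ₛ Φ
    ≈⟨ solve 4 (λ z y A Φ → (con 1ℤ :- z :* y) :* A :* Φ
                          := A :* (con 1ℤ :- y) :* Φ :+ y :* (A :* (con 1ℤ :- z) :* Φ)) ≋-refl z y A Φ ⟩
  A *ₛ (1ₛ -ₛ y) *ₛ Φ +ₛ y *ₛ (A *ₛ (1ₛ -ₛ z) *ₛ Φ)
    ≈⟨ +ₛ-cong (≋-sym (F-sucˡ k i j)) (*ₛ-congˡ y (≋-trans (*ₛ-congʳ Φ (geometric-inverse (6 * suc i) (s≤s z≤n)))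
                                                           (≋-trans (*ₛ-identityˡ Φ) (F-comm k i j)))) ⟩
  F k (suc i) j +ₛ y *ₛ F k j i ∎
  where
  open ≋-Reasoning
  x = qpow (3 * (suc k + suc i ∸ j))
  J = inv6 (suc k)
  Q = qpow (6 * suc k)
  A = inv6 (suc i)
  z = qpow (6 * suc i)
  y = qpow (3 * (k ∸ i ∸ j))
  Φ = F k i j

exponents-sum : ∀ {s} i j n → s ≡ i + j + n → 3 * (s + i ∸ j) + 3 * (s + j ∸ i) ≡ 6 * s
exponents-sum i j n refl = trans
  (cong₂ (λ a b → 3 * a + 3 * b) (∸-excess i j n refl) (∸-excess j i n (cong (_+ n) (ℕₚ.+-comm i j))))
  (total i j n)
  where
  total : ∀ i j n → 3 * (i + i + n) + 3 * (j + j + n) ≡ 6 * (i + j + n)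
  total = solve-∀

F-suc : ∀ k i j → F (suc k) i j ≋ G k i j +ₛ qpow (3 * (suc k + i ∸ j)) *ₛ G k j i
F-suc k i j = ≋-sym (begin
  (1ₛ -ₛ xa) *ₛ J *ₛ Φ +ₛ xa *ₛ ((1ₛ -ₛ xb) *ₛ J *ₛ F s j i)
    ≈⟨ +ₛ-congˡ ((1ₛ -ₛ xa) *ₛ J *ₛ Φ) (*ₛ-congˡ xa (*ₛ-congˡ ((1ₛ -ₛ xb) *ₛ J) (F-comm s j i))) ⟩
  (1ₛ -ₛ xa) *ₛ J *ₛ Φ +ₛ xa *ₛ ((1ₛ -ₛ xb) *ₛ J *ₛ Φ)
    ≈⟨ solve 4 (λ xa xb J Φ → (con 1ℤ :- xa) :* J :* Φ :+ xa :* ((con 1ℤ :- xb) :* J :* Φ)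
                            := J :* (con 1ℤ :- xa :* xb) :* Φ) ≋-refl xa xb J Φ ⟩
  J *ₛ (1ₛ -ₛ xa *ₛ xb) *ₛ Φ
    ≈⟨ *ₛF-cong s i j (λ n s≡i+j+n → ≋-trans (*ₛ-congˡ J (1-ₛ-cong (xa*xb≋Q n s≡i+j+n))) (inv6-inverse k)) ⟩
  1ₛ *ₛ Φ
    ≈⟨ *ₛ-identityˡ Φ ⟩
  Φ ∎)
  where
  open ≋-Reasoning
  s = suc k
  xa = qpow (3 * (s + i ∸ j))
  xb = qpow (3 * (s + j ∸ i))
  J = inv6 s
  Φ = F s i j
  xa*xb≋Q : ∀ n → s ≡ i + j + n → xa *ₛ xb ≋ qpow (6 * s)
  xa*xb≋Q n s≡i+j+n = ≋-trans (qpow-+ _ _) (qpow-cong (exponents-sum i j n s≡i+j+n))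

-- Exponents

-- Each exponent ω(m,·,·), π(m,·,·) has the form 3i² + 3j² - α i + β j with α, β ∈ {1, 2};
-- it is stored with the subtracted term moved to the left.
record Weight : Set where
  field
    exponent : ℕ → ℕ → ℕ
    α β      : ℕ
    offset   : ∀ i j → exponent i j + α * i ≡ 3 * i * i + (3 * j * j + β * j)

open Weight

m*i≤3*i*i : ∀ {m} i → m ≤ 3 → m * i ≤ 3 * i * i
m*i≤3*i*i {m} zero    _   = ℕₚ.≤-reflexive (ℕₚ.*-zeroʳ m)
m*i≤3*i*i     (suc i) m≤3 = ℕₚ.≤-trans (ℕₚ.*-monoˡ-≤ (suc i) m≤3) (ℕₚ.m≤m*n (3 * suc i) (suc i))

ω-offset : ∀ m i j → m ≤ 3 → ω m i j + m * i ≡ 3 * i * i + (3 * j * j + m * j)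
ω-offset m i j m≤3 = trans (swap (3 * i * i ∸ m * i) (3 * j * j + m * j) (m * i))
                           (cong (_+ (3 * j * j + m * j)) (ℕₚ.m∸n+n≡m (m*i≤3*i*i i m≤3)))
  where
  swap : ∀ a b c → a + b + c ≡ a + c + b
  swap = solve-∀

i≤ω₁ : ∀ i j → i ≤ ω 1 i j
i≤ω₁ i j = ℕₚ.+-cancelʳ-≤ i i (ω 1 i j) (begin
  i + i                            ≡⟨ cong (λ z → i + z) (ℕₚ.+-identityʳ i) ⟨
  2 * i                            ≤⟨ m*i≤3*i*i i (s≤s (s≤s z≤n)) ⟩
  3 * i * i                        ≤⟨ ℕₚ.m≤m+n (3 * i * i) (3 * j * j + 1 * j) ⟩
  3 * i * i + (3 * j * j + 1 * j)  ≡⟨ trans (cong (λ z → ω 1 i j + z) (sym (ℕₚ.+-identityʳ i))) (ω-offset 1 i j (s≤s z≤n)) ⟨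
  ω 1 i j + i                      ∎)
  where open ℕₚ.≤-Reasoning

ω₁ ω₂ π₁ π₂ : Weight
ω₁ = record { exponent = ω 1 ; α = 1 ; β = 1 ; offset = λ i j → ω-offset 1 i j (s≤s z≤n) }
ω₂ = record { exponent = ω 2 ; α = 2 ; β = 2 ; offset = λ i j → ω-offset 2 i j (s≤s (s≤s z≤n)) }
π₁ = record { exponent = πe 1 ; α = 2 ; β = 1 ; offset = offset₁ }
  where
  offset₁ : ∀ i j → πe 1 i j + 2 * i ≡ 3 * i * i + (3 * j * j + 1 * j)
  offset₁ i j = begin
    ω 1 i j ∸ i + (i + (i + 0))   ≡⟨ shuffle (ω 1 i j ∸ i) i ⟩
    ω 1 i j ∸ i + i + 1 * i       ≡⟨ cong (_+ 1 * i) (ℕₚ.m∸n+n≡m (i≤ω₁ i j)) ⟩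
    ω 1 i j + 1 * i               ≡⟨ ω-offset 1 i j (s≤s z≤n) ⟩
    3 * i * i + (3 * j * j + 1 * j) ∎
    where
    open ≡-Reasoning
    shuffle : ∀ a i → a + (i + (i + 0)) ≡ a + i + 1 * i
    shuffle = solve-∀
π₂ = record { exponent = πe 2 ; α = 1 ; β = 2 ; offset = offset₂ }
  where
  offset₂ : ∀ i j → πe 2 i j + 1 * i ≡ 3 * i * i + (3 * j * j + 2 * j)
  offset₂ i j = trans (shuffle (ω 2 i j) i) (ω-offset 2 i j (s≤s (s≤s z≤n)))
    where
    shuffle : ∀ a i → a + i + 1 * i ≡ a + 2 * i
    shuffle = solve-∀

-- The partner of a weight: prepending a part to a partition swaps the roles of (i, j),
-- and ω₁ ↔ ω₂, π₁ ↔ π₁, π₂ ↔ π₂ are exactly the pairs for which the exponents match up.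
record Dual (w w′ : Weight) : Set where
  field
    βα : β w′ + α w ≡ 3
    αβ : β w + α w′ ≡ 3

module _ {w w′ : Weight} (d : Dual w w′) where
  open Dual d

  private
    E = exponent w
    E′ = exponent w′

    partner-offset : ∀ i j → E′ j i + (α w′ * j + α w * i) ≡ 3 * (i * i + j * j + i)
    partner-offset i j = begin
      E′ j i + (α w′ * j + α w * i)                          ≡⟨ assoc (E′ j i) (α w′ * j) (α w * i) ⟩
      E′ j i + α w′ * j + α w * i                            ≡⟨ cong (_+ α w * i) (offset w′ j i) ⟩
      3 * j * j + (3 * i * i + β w′ * i) + α w * i           ≡⟨ collect i j (β w′) (α w) ⟩
      3 * (j * j) + 3 * (i * i) + (β w′ + α w) * i           ≡⟨ cong (λ c → 3 * (j * j) + 3 * (i * i) + c * i) βα ⟩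
      3 * (j * j) + 3 * (i * i) + 3 * i                      ≡⟨ final i j ⟩
      3 * (i * i + j * j + i)                                ∎
      where
      open ≡-Reasoning
      assoc : ∀ a b c → a + (b + c) ≡ a + b + c
      assoc = solve-∀
      collect : ∀ i j b a → 3 * j * j + (3 * i * i + b * i) + a * i ≡ 3 * (j * j) + 3 * (i * i) + (b + a) * i
      collect = solve-∀
      final : ∀ i j → 3 * (j * j) + 3 * (i * i) + 3 * i ≡ 3 * (i * i + j * j + i)
      final = solve-∀

    own-offset : ∀ i j → E i j + (α w′ * j + α w * i) ≡ 3 * (i * i + j * j + j)
    own-offset i j = begin
      E i j + (α w′ * j + α w * i)                           ≡⟨ assoc (E i j) (α w′ * j) (α w * i) ⟩
      E i j + α w * i + α w′ * j                             ≡⟨ cong (_+ α w′ * j) (offset w i j) ⟩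
      3 * i * i + (3 * j * j + β w * j) + α w′ * j           ≡⟨ collect i j (β w) (α w′) ⟩
      3 * (i * i) + 3 * (j * j) + (β w + α w′) * j           ≡⟨ cong (λ c → 3 * (i * i) + 3 * (j * j) + c * j) αβ ⟩
      3 * (i * i) + 3 * (j * j) + 3 * j                      ≡⟨ final i j ⟩
      3 * (i * i + j * j + j)                                ∎
      where
      open ≡-Reasoning
      assoc : ∀ e a b → e + (a + b) ≡ e + b + a
      assoc = solve-∀
      collect : ∀ i j b a → 3 * i * i + (3 * j * j + b * j) + a * j ≡ 3 * (i * i) + 3 * (j * j) + (b + a) * j
      collect = solve-∀
      final : ∀ i j → 3 * (i * i) + 3 * (j * j) + 3 * j ≡ 3 * (i * i + j * j + j)
      final = solve-∀

  -- The exponent identity behind G_k(i+1,j) = F_k(i+1,j) + q^{3n} F_k(j,i), k = i+j+n.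
  G-exponent : ∀ c → c + α w ≡ 3 → ∀ {k} i j n → k ≡ i + j + n →
    3 * k + c + E′ j i ≡ E (suc i) j + 3 * n
  G-exponent c cα i j n refl = ℕₚ.+-cancelʳ-≡ (α w′ * j + α w * suc i) _ _ (begin
    3 * (i + j + n) + c + E′ j i + (α w′ * j + α w * suc i)
      ≡⟨ shuffle (i + j + n) c (E′ j i) (α w′ * j) (α w) i ⟩
    3 * (i + j + n) + (c + α w) + (E′ j i + (α w′ * j + α w * i))
      ≡⟨ cong₂ (λ a b → 3 * (i + j + n) + a + b) cα (partner-offset i j) ⟩
    3 * (i + j + n) + 3 + 3 * (i * i + j * j + i)
      ≡⟨ polynomial i j n ⟩
    3 * (suc i * suc i + j * j + j) + 3 * n
      ≡⟨ cong (_+ 3 * n) (own-offset (suc i) j) ⟨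
    E (suc i) j + (α w′ * j + α w * suc i) + 3 * n
      ≡⟨ swap (E (suc i) j) (α w′ * j + α w * suc i) (3 * n) ⟩
    E (suc i) j + 3 * n + (α w′ * j + α w * suc i) ∎)
    where
    open ≡-Reasoning
    shuffle : ∀ m c e b a i → 3 * m + c + e + (b + a * suc i) ≡ 3 * m + (c + a) + (e + (b + a * i))
    shuffle = solve-∀
    polynomial : ∀ i j n → 3 * (i + j + n) + 3 + 3 * (i * i + j * j + i) ≡ 3 * (suc i * suc i + j * j + j) + 3 * n
    polynomial = solve-∀
    swap : ∀ a b c → a + b + c ≡ a + c + b
    swap = solve-∀

  -- The exponent identity behind F_{k+1}(i,j) = G_k(i,j) + q^{3(2i+n)} G_k(j,i), k+1 = i+j+n.
  F-exponent : ∀ {s} i j n → s ≡ i + j + n → 3 * s + E′ j i ≡ E i j + 3 * (i + i + n)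
  F-exponent i j n refl = ℕₚ.+-cancelʳ-≡ (α w′ * j + α w * i) _ _ (begin
    3 * (i + j + n) + E′ j i + (α w′ * j + α w * i)      ≡⟨ ℕₚ.+-assoc (3 * (i + j + n)) (E′ j i) _ ⟩
    3 * (i + j + n) + (E′ j i + (α w′ * j + α w * i))    ≡⟨ cong (λ z → 3 * (i + j + n) + z) (partner-offset i j) ⟩
    3 * (i + j + n) + 3 * (i * i + j * j + i)            ≡⟨ polynomial i j n ⟩
    3 * (i * i + j * j + j) + 3 * (i + i + n)            ≡⟨ cong (_+ 3 * (i + i + n)) (own-offset i j) ⟨
    E i j + (α w′ * j + α w * i) + 3 * (i + i + n)       ≡⟨ swap (E i j) (α w′ * j + α w * i) (3 * (i + i + n)) ⟩
    E i j + 3 * (i + i + n) + (α w′ * j + α w * i)       ∎)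
    where
    open ≡-Reasoning
    polynomial : ∀ i j n → 3 * (i + j + n) + 3 * (i * i + j * j + i) ≡ 3 * (i * i + j * j + j) + 3 * (i + i + n)
    polynomial = solve-∀
    swap : ∀ a b c → a + b + c ≡ a + c + b
    swap = solve-∀

ω₁-ω₂ : Dual ω₁ ω₂
ω₁-ω₂ = record { βα = refl ; αβ = refl }

ω₂-ω₁ : Dual ω₂ ω₁
ω₂-ω₁ = record { βα = refl ; αβ = refl }

π₁-π₁ : Dual π₁ π₁
π₁-π₁ = record { βα = refl ; αβ = refl }

π₂-π₂ : Dual π₂ π₂
π₂-π₂ = record { βα = refl ; αβ = refl }

collect-qpow : ∀ eL eM eR c X Y → qpow (eM + eR) *ₛ Y ≋ qpow (eL + c) *ₛ Y →
  qpow eL *ₛ X +ₛ qpow eM *ₛ (qpow eR *ₛ Y) ≋ qpow eL *ₛ (X +ₛ qpow c *ₛ Y)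
collect-qpow eL eM eR c X Y exponents≋ = begin
  qpow eL *ₛ X +ₛ qpow eM *ₛ (qpow eR *ₛ Y)
    ≈⟨ +ₛ-congˡ (qpow eL *ₛ X) (≋-trans (≋-sym (*ₛ-assoc (qpow eM) (qpow eR) Y)) (*ₛ-congʳ Y (qpow-+ eM eR))) ⟩
  qpow eL *ₛ X +ₛ qpow (eM + eR) *ₛ Y
    ≈⟨ +ₛ-congˡ (qpow eL *ₛ X) exponents≋ ⟩
  qpow eL *ₛ X +ₛ qpow (eL + c) *ₛ Y
    ≈⟨ +ₛ-congˡ (qpow eL *ₛ X) (≋-trans (*ₛ-congʳ Y (≋-sym (qpow-+ eL c))) (*ₛ-assoc (qpow eL) (qpow c) Y)) ⟩
  qpow eL *ₛ X +ₛ qpow eL *ₛ (qpow c *ₛ Y)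
    ≈⟨ *ₛ-distribˡ (qpow eL) X (qpow c *ₛ Y) ⟨
  qpow eL *ₛ (X +ₛ qpow c *ₛ Y) ∎
  where open ≋-Reasoning

*ₛG-cong : ∀ {A B} k i j → (∀ n → suc k ≡ i + j + n → A ≋ B) → A *ₛ G k i j ≋ B *ₛ G k i j
*ₛG-cong {A} {B} k i j A≋B = begin
  A *ₛ (C *ₛ F (suc k) i j)   ≈⟨ solve 3 (λ A C f → A :* (C :* f) := C :* (A :* f)) ≋-refl A C (F (suc k) i j) ⟩
  C *ₛ (A *ₛ F (suc k) i j)   ≈⟨ *ₛ-congˡ C (*ₛF-cong (suc k) i j A≋B) ⟩
  C *ₛ (B *ₛ F (suc k) i j)   ≈⟨ solve 3 (λ B C f → C :* (B :* f) := B :* (C :* f)) ≋-refl B C (F (suc k) i j) ⟩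
  B *ₛ (C *ₛ F (suc k) i j)   ∎
  where
  open ≋-Reasoning
  C = (1ₛ -ₛ qpow (3 * (suc k + i ∸ j))) *ₛ inv6 (suc k)

combine-G : ∀ k i j eL eM eR → (∀ n → k ≡ i + j + n → eM + eR ≡ eL + 3 * n) →
  qpow eL *ₛ F k (suc i) j +ₛ qpow eM *ₛ (qpow eR *ₛ F k j i) ≋ qpow eL *ₛ G k (suc i) j
combine-G k i j eL eM eR exponents = ≋-trans
  (collect-qpow eL eM eR (3 * (k ∸ i ∸ j)) (F k (suc i) j) (F k j i)
    (*ₛF-cong k j i (λ n k≡j+i+n → qpow-cong (
      let k≡i+j+n = trans k≡j+i+n (cong (_+ n) (ℕₚ.+-comm j i))
      in trans (exponents n k≡i+j+n) (cong (λ m → eL + 3 * m) (sym (∸-∸-by i j n k≡i+j+n)))))))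
  (*ₛ-congˡ (qpow eL) (≋-sym (G-suc k i j)))

combine-F : ∀ k i j eL eM eR → (∀ n → suc k ≡ i + j + n → eM + eR ≡ eL + 3 * (i + i + n)) →
  qpow eL *ₛ G k i j +ₛ qpow eM *ₛ (qpow eR *ₛ G k j i) ≋ qpow eL *ₛ F (suc k) i j
combine-F k i j eL eM eR exponents = ≋-trans
  (collect-qpow eL eM eR (3 * (suc k + i ∸ j)) (G k i j) (G k j i)
    (*ₛG-cong k j i (λ n 1+k≡j+i+n → qpow-cong (
      let 1+k≡i+j+n = trans 1+k≡j+i+n (cong (_+ n) (ℕₚ.+-comm j i))
      in trans (exponents n 1+k≡i+j+n) (cong (λ m → eL + 3 * m) (sym (∸-excess i j n 1+k≡i+j+n)))))))
  (*ₛ-congˡ (qpow eL) (≋-sym (F-suc k i j)))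

-- Counting partitions

count : ∀ {A : Set} → (A → Bool) → List A → ℕ
count p xs = length (filterᵇ p xs)

count-∷ : ∀ {A : Set} (p : A → Bool) x xs → count p (x ∷ xs) ≡ (if p x then 1 else 0) + count p xs
count-∷ p x xs with p x
... | true  = refl
... | false = refl

count-++ : ∀ {A : Set} (p : A → Bool) xs ys → count p (xs ++ ys) ≡ count p xs + count p ys
count-++ p xs ys = trans (cong length (Listₚ.filter-++ _ xs ys)) (Listₚ.length-++ (filterᵇ p xs))

count-map : ∀ {A B : Set} (p : B → Bool) (f : A → B) xs → count p (map f xs) ≡ count (p ∘ f) xs
count-map p f []       = refl
count-map p f (x ∷ xs) rewrite count-∷ p (f x) (map f xs) | count-∷ (p ∘ f) x xs | count-map p f xs = refl

count-filterᵇ : ∀ {A : Set} (p q : A → Bool) xs → count p (filterᵇ q xs) ≡ count (λ x → q x ∧ p x) xs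
count-filterᵇ p q []       = refl
count-filterᵇ p q (x ∷ xs) rewrite count-∷ (λ x → q x ∧ p x) x xs with q x
... | false = count-filterᵇ p q xs
... | true rewrite count-∷ p x (filterᵇ q xs) | count-filterᵇ p q xs = refl

count-congᴬ : ∀ {A : Set} {Q : A → Set} (p p′ : A → Bool) {xs} → All Q xs →
  (∀ x → Q x → p x ≡ p′ x) → count p xs ≡ count p′ xs
count-congᴬ p p′ []                  _   = refl
count-congᴬ p p′ {x ∷ xs} (qx ∷ qxs) p≗p′
  rewrite count-∷ p x xs | count-∷ p′ x xs | p≗p′ x qx | count-congᴬ p p′ qxs p≗p′ = refl

count-cong : ∀ {A : Set} (p p′ : A → Bool) xs → (∀ x → p x ≡ p′ x) → count p xs ≡ count p′ xs
count-cong p p′ []       _    = refl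
count-cong p p′ (x ∷ xs) p≗p′ rewrite count-∷ p x xs | count-∷ p′ x xs | p≗p′ x | count-cong p p′ xs p≗p′ = refl

count-false : ∀ {A : Set} (xs : List A) → count (λ _ → false) xs ≡ 0
count-false []       = refl
count-false (_ ∷ xs) = count-false xs

admissible : List ℕ → Bool
admissible π = not (badPair π π)

distinctParts-≤ : ∀ M → All (All (_≤ M)) (distinctParts M)
distinctParts-≤ zero    = [] ∷ []
distinctParts-≤ (suc M) = ++⁺ (All.map (All.map ℕₚ.m≤n⇒m≤1+n) (distinctParts-≤ M))
                              (map⁺ (All.map (λ π≤M → ℕₚ.≤-refl ∷ All.map ℕₚ.m≤n⇒m≤1+n π≤M) (distinctParts-≤ M)))

elemᵇ-> : ∀ {M x} π → All (_≤ M) π → M < x → elemᵇ x π ≡ false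
elemᵇ-> []      []           _   = refl
elemᵇ-> {x = x} (y ∷ π) (y≤M ∷ π≤M) M<x rewrite elemᵇ-> π π≤M M<x =
  trans (𝔹ₚ.∨-identityʳ _) (⌊⌋-false (x ℕ.≟ y) (λ x≡y → ℕₚ.<-irrefl (sym x≡y) (ℕₚ.≤-<-trans y≤M M<x)))

-- Both sides say that p = M ≡ 1 (mod 3).
same-part : ∀ p M → ⌊ p % 3 ℕ.≟ 1 ⌋ ∧ ⌊ suc p ℕ.≟ suc M ⌋ ≡ ⌊ M % 3 ℕ.≟ 1 ⌋ ∧ ⌊ M ℕ.≟ p ⌋
same-part p M with p ℕ.≟ M
... | yes refl = cong (⌊ p % 3 ℕ.≟ 1 ⌋ ∧_) (trans (⌊⌋-true (suc p ℕ.≟ suc p) refl) (sym (⌊⌋-true (p ℕ.≟ p) refl)))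
... | no p≢M   = trans (cong (⌊ p % 3 ℕ.≟ 1 ⌋ ∧_) (⌊⌋-false (suc p ℕ.≟ suc M) (p≢M ∘ ℕₚ.suc-injective)))
                (trans (𝔹ₚ.∧-zeroʳ _) (sym (trans (cong (⌊ M % 3 ℕ.≟ 1 ⌋ ∧_) (⌊⌋-false (M ℕ.≟ p) (p≢M ∘ sym)))
                                                  (𝔹ₚ.∧-zeroʳ _))))

∨-interchange : ∀ a b c d → (a ∨ b) ∨ (c ∨ d) ≡ (b ∨ c) ∨ (a ∨ d)
∨-interchange false b c d = sym (𝔹ₚ.∨-assoc b c d)
∨-interchange true  b c d = sym (𝔹ₚ.∨-zeroʳ (b ∨ c))

badPair-∷ : ∀ M ρ σ → badPair (suc M ∷ ρ) σ ≡ badPair ρ σ ∨ (⌊ M % 3 ℕ.≟ 1 ⌋ ∧ elemᵇ M σ)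
badPair-∷ M ρ []      = sym (𝔹ₚ.∧-zeroʳ _)
badPair-∷ M ρ (p ∷ σ) = begin
  (r ∧ (t ∨ E)) ∨ badPair (suc M ∷ ρ) σ    ≡⟨ cong₂ _∨_ (𝔹ₚ.∧-distribˡ-∨ r t E) (badPair-∷ M ρ σ) ⟩
  ((r ∧ t) ∨ (r ∧ E)) ∨ (B ∨ (r′ ∧ S))     ≡⟨ cong (λ x → (x ∨ (r ∧ E)) ∨ (B ∨ (r′ ∧ S))) (same-part p M) ⟩
  ((r′ ∧ t′) ∨ (r ∧ E)) ∨ (B ∨ (r′ ∧ S))   ≡⟨ ∨-interchange (r′ ∧ t′) (r ∧ E) B (r′ ∧ S) ⟩
  ((r ∧ E) ∨ B) ∨ ((r′ ∧ t′) ∨ (r′ ∧ S))   ≡⟨ cong (((r ∧ E) ∨ B) ∨_) (𝔹ₚ.∧-distribˡ-∨ r′ t′ S) ⟨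
  ((r ∧ E) ∨ B) ∨ (r′ ∧ (t′ ∨ S))          ∎
  where
  open ≡-Reasoning
  r = ⌊ p % 3 ℕ.≟ 1 ⌋
  t = ⌊ suc p ℕ.≟ suc M ⌋
  E = elemᵇ (suc p) ρ
  B = badPair ρ σ
  r′ = ⌊ M % 3 ℕ.≟ 1 ⌋
  t′ = ⌊ M ℕ.≟ p ⌋
  S = elemᵇ M σ

admissible-∷ : ∀ M π → All (_≤ M) π →
  admissible (suc M ∷ π) ≡ admissible π ∧ not (⌊ M % 3 ℕ.≟ 1 ⌋ ∧ elemᵇ M π)
admissible-∷ M π π≤M = begin
  not ((⌊ suc M % 3 ℕ.≟ 1 ⌋ ∧ (⌊ 2 + M ℕ.≟ suc M ⌋ ∨ elemᵇ (2 + M) π)) ∨ badPair (suc M ∷ π) π)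
    ≡⟨ cong (λ x → not ((⌊ suc M % 3 ℕ.≟ 1 ⌋ ∧ x) ∨ badPair (suc M ∷ π) π))
            (cong₂ _∨_ (⌊⌋-false (2 + M ℕ.≟ suc M) ℕₚ.1+n≢n)
                       (elemᵇ-> π π≤M (s≤s (ℕₚ.n≤1+n M)))) ⟩
  not ((⌊ suc M % 3 ℕ.≟ 1 ⌋ ∧ false) ∨ badPair (suc M ∷ π) π)
    ≡⟨ cong (λ x → not (x ∨ badPair (suc M ∷ π) π)) (𝔹ₚ.∧-zeroʳ _) ⟩
  not (badPair (suc M ∷ π) π)
    ≡⟨ cong not (badPair-∷ M π π) ⟩
  not (badPair π π ∨ (⌊ M % 3 ℕ.≟ 1 ⌋ ∧ elemᵇ M π))
    ≡⟨ not-∨ (badPair π π) _ ⟩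
  admissible π ∧ not (⌊ M % 3 ℕ.≟ 1 ⌋ ∧ elemᵇ M π) ∎
  where
  open ≡-Reasoning
  not-∨ : ∀ a b → not (a ∨ b) ≡ not a ∧ not b
  not-∨ false b = refl
  not-∨ true  b = refl

count-DS3-suc : ∀ M (C : List ℕ → Bool) → count C (DS3 (suc M)) ≡
  count C (DS3 M) + count (λ π → admissible (suc M ∷ π) ∧ C (suc M ∷ π)) (distinctParts M)
count-DS3-suc M C = begin
  count C (DS3 (suc M))
    ≡⟨ count-filterᵇ C admissible (distinctParts M ++ map (suc M ∷_) (distinctParts M)) ⟩
  count admissibleC (distinctParts M ++ map (suc M ∷_) (distinctParts M))
    ≡⟨ count-++ admissibleC (distinctParts M) (map (suc M ∷_) (distinctParts M)) ⟩
  count admissibleC (distinctParts M) + count admissibleC (map (suc M ∷_) (distinctParts M))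
    ≡⟨ cong₂ _+_ (sym (count-filterᵇ C admissible (distinctParts M))) (count-map admissibleC (suc M ∷_) (distinctParts M)) ⟩
  count C (DS3 M) + count (λ π → admissible (suc M ∷ π) ∧ C (suc M ∷ π)) (distinctParts M) ∎
  where
  open ≡-Reasoning
  admissibleC : List ℕ → Bool
  admissibleC π = admissible π ∧ C π

admissible-∷-free : ∀ M π → M % 3 ≢ 1 → All (_≤ M) π → admissible (suc M ∷ π) ≡ admissible π
admissible-∷-free M π M≢1 π≤M = begin
  admissible (suc M ∷ π)                              ≡⟨ admissible-∷ M π π≤M ⟩
  admissible π ∧ not (⌊ M % 3 ℕ.≟ 1 ⌋ ∧ elemᵇ M π)    ≡⟨ cong (λ b → admissible π ∧ not (b ∧ elemᵇ M π))
                                                                (⌊⌋-false (M % 3 ℕ.≟ 1) M≢1) ⟩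
  admissible π ∧ true                                 ≡⟨ 𝔹ₚ.∧-identityʳ (admissible π) ⟩
  admissible π                                        ∎
  where open ≡-Reasoning

admissible-∷-gap : ∀ M π → All (_≤ M) π → admissible (2 + M ∷ π) ≡ admissible π
admissible-∷-gap M π π≤M = begin
  admissible (2 + M ∷ π)                                        ≡⟨ admissible-∷ (suc M) π (All.map ℕₚ.m≤n⇒m≤1+n π≤M) ⟩
  admissible π ∧ not (⌊ suc M % 3 ℕ.≟ 1 ⌋ ∧ elemᵇ (suc M) π)    ≡⟨ cong (λ b → admissible π ∧ not (⌊ suc M % 3 ℕ.≟ 1 ⌋ ∧ b))
                                                                          (elemᵇ-> π π≤M ℕₚ.≤-refl) ⟩
  admissible π ∧ not (⌊ suc M % 3 ℕ.≟ 1 ⌋ ∧ false)              ≡⟨ cong (λ b → admissible π ∧ not b) (𝔹ₚ.∧-zeroʳ _) ⟩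
  admissible π ∧ true                                           ≡⟨ 𝔹ₚ.∧-identityʳ (admissible π) ⟩
  admissible π                                                  ∎
  where open ≡-Reasoning

admissible-∷-pair : ∀ M π → suc M % 3 ≡ 1 → All (_≤ M) π → admissible (2 + M ∷ suc M ∷ π) ≡ false
admissible-∷-pair M π 1+M≡1 π≤M = begin
  admissible (2 + M ∷ suc M ∷ π)
    ≡⟨ admissible-∷ (suc M) (suc M ∷ π) (ℕₚ.≤-refl ∷ All.map ℕₚ.m≤n⇒m≤1+n π≤M) ⟩
  admissible (suc M ∷ π) ∧ not (⌊ suc M % 3 ℕ.≟ 1 ⌋ ∧ (⌊ suc M ℕ.≟ suc M ⌋ ∨ elemᵇ (suc M) π))
    ≡⟨ cong₂ (λ a b → admissible (suc M ∷ π) ∧ not (a ∧ (b ∨ elemᵇ (suc M) π)))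
             (⌊⌋-true (suc M % 3 ℕ.≟ 1) 1+M≡1) (⌊⌋-true (suc M ℕ.≟ suc M) refl) ⟩
  admissible (suc M ∷ π) ∧ false
    ≡⟨ 𝔹ₚ.∧-zeroʳ _ ⟩
  false ∎
  where open ≡-Reasoning

-- A largest part M+1 ≢ 2 (mod 3) can be added to any admissible partition with parts ≤ M.
count-DS3-free : ∀ M → M % 3 ≢ 1 → ∀ (C : List ℕ → Bool) →
  count C (DS3 (suc M)) ≡ count C (DS3 M) + count (C ∘ (suc M ∷_)) (DS3 M)
count-DS3-free M M≢1 C = trans (count-DS3-suc M C) (cong (count C (DS3 M) +_) (trans
  (count-congᴬ _ (λ π → admissible π ∧ C (suc M ∷ π)) (distinctParts-≤ M)
    (λ π π≤M → cong (_∧ C (suc M ∷ π)) (admissible-∷-free M π M≢1 π≤M)))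
  (sym (count-filterᵇ (C ∘ (suc M ∷_)) admissible (distinctParts M)))))

-- A largest part M+2 ≡ 2 (mod 3) excludes the part M+1 ≡ 1 (mod 3).
count-DS3-excluding : ∀ M → suc M % 3 ≡ 1 → ∀ (C : List ℕ → Bool) →
  count C (DS3 (2 + M)) ≡ count C (DS3 (suc M)) + count (C ∘ (2 + M ∷_)) (DS3 M)
count-DS3-excluding M 1+M≡1 C = trans (count-DS3-suc (suc M) C) (cong (count C (DS3 (suc M)) +_) (begin
  count withTop (distinctParts M ++ map (suc M ∷_) (distinctParts M))
    ≡⟨ count-++ withTop (distinctParts M) (map (suc M ∷_) (distinctParts M)) ⟩
  count withTop (distinctParts M) + count withTop (map (suc M ∷_) (distinctParts M))
    ≡⟨ cong₂ _+_ withoutM+1 (trans (count-map withTop (suc M ∷_) (distinctParts M)) withM+1) ⟩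
  count (C ∘ (2 + M ∷_)) (DS3 M) + 0
    ≡⟨ ℕₚ.+-identityʳ _ ⟩
  count (C ∘ (2 + M ∷_)) (DS3 M) ∎))
  where
  open ≡-Reasoning
  withTop : List ℕ → Bool
  withTop π = admissible (2 + M ∷ π) ∧ C (2 + M ∷ π)
  withoutM+1 : count withTop (distinctParts M) ≡ count (C ∘ (2 + M ∷_)) (DS3 M)
  withoutM+1 = trans
    (count-congᴬ withTop (λ π → admissible π ∧ C (2 + M ∷ π)) (distinctParts-≤ M)
      (λ π π≤M → cong (_∧ C (2 + M ∷ π)) (admissible-∷-gap M π π≤M)))
    (sym (count-filterᵇ (C ∘ (2 + M ∷_)) admissible (distinctParts M)))
  withM+1 : count (withTop ∘ (suc M ∷_)) (distinctParts M) ≡ 0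
  withM+1 = trans
    (count-congᴬ (withTop ∘ (suc M ∷_)) (λ _ → false) (distinctParts-≤ M)
      (λ π π≤M → cong (_∧ C (2 + M ∷ suc M ∷ π)) (admissible-∷-pair M π 1+M≡1 π≤M)))
    (count-false (distinctParts M))

hasStatistics : ℕ → ℕ → ℕ → ℕ → ℕ → List ℕ → Bool
hasStatistics a b c d n π =
  ⌊ o 1 π ℕ.≟ a ⌋ ∧ ⌊ o 2 π ℕ.≟ b ⌋ ∧ ⌊ e 1 π ℕ.≟ c ⌋ ∧ ⌊ e 2 π ℕ.≟ d ⌋ ∧ ⌊ sum π ℕ.≟ n ⌋

counts : List (List ℕ) → ℕ → ℕ → ℕ → ℕ → Series
counts L a b c d n = ℤ.+ count (hasStatistics a b c d n) L

countsWithTop : List (List ℕ) → ℕ → ℕ → ℕ → ℕ → ℕ → Series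
countsWithTop L p a b c d n = ℤ.+ count (hasStatistics a b c d n ∘ (p ∷_)) L

residue : ℕ → ℕ → ℕ
residue r p = if ⌊ p % 3 ℕ.≟ r ⌋ then 1 else 0

∧-swap₄ : ∀ {a a′ b b′ e e′} c d → a ≡ a′ → b ≡ b′ → e ≡ e′ → a ∧ b ∧ c ∧ d ∧ e ≡ c ∧ d ∧ a′ ∧ b′ ∧ e′
∧-swap₄ {true}  {b = true}  c d refl refl refl = refl
∧-swap₄ {true}  {b = false} c d refl refl refl = sym (∧-false c d)
  where
  ∧-false : ∀ c d → c ∧ d ∧ false ≡ false
  ∧-false c d = trans (cong (c ∧_) (𝔹ₚ.∧-zeroʳ d)) (𝔹ₚ.∧-zeroʳ c)
∧-swap₄ {false}             c d refl refl refl = sym (trans (cong (c ∧_) (𝔹ₚ.∧-zeroʳ d)) (𝔹ₚ.∧-zeroʳ c))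

-- Prepending p to π swaps odd- and even-indexed parts; p itself becomes odd-indexed.
hasStatistics-∷ : ∀ {p n} a b c d π → p ≤ n →
  hasStatistics (residue 1 p + a) (residue 2 p + b) c d n (p ∷ π) ≡ hasStatistics c d a b (n ∸ p) π
hasStatistics-∷ {p} {n} a b c d π p≤n = ∧-swap₄ ⌊ o 1 π ℕ.≟ c ⌋ ⌊ o 2 π ℕ.≟ d ⌋
  (≟-cancelˡ (residue 1 p) (e 1 π) a) (≟-cancelˡ (residue 2 p) (e 2 π) b)
  (⌊⌋-⇔ (p + sum π ℕ.≟ n) (sum π ℕ.≟ n ∸ p) (λ p+s≡n → sym (∸-by (sum π) p (trans (sym p+s≡n) (ℕₚ.+-comm p (sum π)))))
                                           (λ s≡n∸p → trans (cong (p +_) s≡n∸p) (ℕₚ.m+[n∸m]≡n p≤n)))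
  where
  ≟-cancelˡ : ∀ k x y → ⌊ k + x ℕ.≟ k + y ⌋ ≡ ⌊ x ℕ.≟ y ⌋
  ≟-cancelˡ k x y = ⌊⌋-⇔ (k + x ℕ.≟ k + y) (x ℕ.≟ y) (ℕₚ.+-cancelˡ-≡ k x y) (cong (k +_))

hasStatistics-∷-large : ∀ {p n} a b c d π → n < p → hasStatistics a b c d n (p ∷ π) ≡ false
hasStatistics-∷-large {p} {n} a b c d π n<p = trans
  (cong (λ x → A ∧ B ∧ C ∧ D ∧ x) (⌊⌋-false (p + sum π ℕ.≟ n)
    (λ p+s≡n → ℕₚ.<⇒≱ n<p (subst (p ≤_) p+s≡n (ℕₚ.m≤m+n p (sum π))))))
  (trans (cong (λ x → A ∧ B ∧ C ∧ x) (𝔹ₚ.∧-zeroʳ D)) (trans (cong (λ x → A ∧ B ∧ x) (𝔹ₚ.∧-zeroʳ C))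
    (trans (cong (A ∧_) (𝔹ₚ.∧-zeroʳ B)) (𝔹ₚ.∧-zeroʳ A))))
  where
  A = ⌊ o 1 (p ∷ π) ℕ.≟ a ⌋
  B = ⌊ o 2 (p ∷ π) ℕ.≟ b ⌋
  C = ⌊ e 1 (p ∷ π) ℕ.≟ c ⌋
  D = ⌊ e 2 (p ∷ π) ℕ.≟ d ⌋

countsWithTop-≋ : ∀ L p {a′ b′} a b c d → residue 1 p + a ≡ a′ → residue 2 p + b ≡ b′ →
  countsWithTop L p a′ b′ c d ≋ qpow p *ₛ counts L c d a b
countsWithTop-≋ L p a b c d refl refl n rewrite qpow-*ₛ p (counts L c d a b) n with p ≤? n
... | yes p≤n = cong ℤ.+_ (count-cong _ _ L (λ π → hasStatistics-∷ a b c d π p≤n))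
... | no p≰n  = cong ℤ.+_ (trans (count-cong _ _ L (λ π → hasStatistics-∷-large _ _ c d π (ℕₚ.≰⇒> p≰n)))
                                  (count-false L))

countsWithTop-vanishes : ∀ L p a b c d → (∀ n π → hasStatistics a b c d n (p ∷ π) ≡ false) →
  countsWithTop L p a b c d ≋ 0ₛ
countsWithTop-vanishes L p a b c d never n = cong ℤ.+_ (trans (count-cong _ _ L (never n)) (count-false L))

PCoeff-free : ∀ M → M % 3 ≢ 1 → ∀ a b c d →
  PCoeff (suc M) a b c d ≋ PCoeff M a b c d +ₛ countsWithTop (DS3 M) (suc M) a b c d
PCoeff-free M M≢1 a b c d n =
  trans (cong ℤ.+_ (count-DS3-free M M≢1 C)) (ℤₚ.pos-+ (count C (DS3 M)) (count (C ∘ (suc M ∷_)) (DS3 M)))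
  where C = hasStatistics a b c d n

PCoeff-excluding : ∀ M → suc M % 3 ≡ 1 → ∀ a b c d →
  PCoeff (2 + M) a b c d ≋ PCoeff (suc M) a b c d +ₛ countsWithTop (DS3 M) (2 + M) a b c d
PCoeff-excluding M 1+M≡1 a b c d n =
  trans (cong ℤ.+_ (count-DS3-excluding M 1+M≡1 C)) (ℤₚ.pos-+ (count C (DS3 (suc M))) (count (C ∘ (2 + M ∷_)) (DS3 M)))
  where C = hasStatistics a b c d n

hasStatistics-∷-o₁ : ∀ {p} b c d n π → residue 1 p ≡ 1 → hasStatistics 0 b c d n (p ∷ π) ≡ false
hasStatistics-∷-o₁ {p} b c d n π r≡1 = cong (_∧ hasStatistics-from₂ b c d n (p ∷ π)) (⌊⌋-false (residue 1 p + e 1 π ℕ.≟ 0)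
  (λ o₁≡0 → ℕₚ.1+n≢0 (trans (cong (_+ e 1 π) (sym r≡1)) o₁≡0)))
  where
  hasStatistics-from₂ : ℕ → ℕ → ℕ → ℕ → List ℕ → Bool
  hasStatistics-from₂ b c d n π = ⌊ o 2 π ℕ.≟ b ⌋ ∧ ⌊ e 1 π ℕ.≟ c ⌋ ∧ ⌊ e 2 π ℕ.≟ d ⌋ ∧ ⌊ sum π ℕ.≟ n ⌋

hasStatistics-∷-o₂ : ∀ {p} a c d n π → residue 2 p ≡ 1 → hasStatistics a 0 c d n (p ∷ π) ≡ false
hasStatistics-∷-o₂ {p} a c d n π r≡1 = trans
  (cong (λ x → ⌊ o 1 (p ∷ π) ℕ.≟ a ⌋ ∧ x ∧ hasStatistics-from₃ c d n (p ∷ π)) (⌊⌋-false (residue 2 p + e 2 π ℕ.≟ 0)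
    (λ o₂≡0 → ℕₚ.1+n≢0 (trans (cong (_+ e 2 π) (sym r≡1)) o₂≡0))))
  (𝔹ₚ.∧-zeroʳ ⌊ o 1 (p ∷ π) ℕ.≟ a ⌋)
  where
  hasStatistics-from₃ : ℕ → ℕ → ℕ → List ℕ → Bool
  hasStatistics-from₃ c d n π = ⌊ e 1 π ℕ.≟ c ⌋ ∧ ⌊ e 2 π ℕ.≟ d ⌋ ∧ ⌊ sum π ℕ.≟ n ⌋

%3-of : ∀ {p} k m → p ≡ 3 * k + m → m < 3 → p % 3 ≡ m
%3-of k m refl m<3 = trans (cong (_% 3) (trans (ℕₚ.+-comm (3 * k) m) (cong (m +_) (ℕₚ.*-comm 3 k))))
                           (trans (DivMod.[m+kn]%n≡m%n m k 3) (DivMod.m<n⇒m%n≡m m<3))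

residue-of : ∀ {p} r k m → p ≡ 3 * k + m → m < 3 → residue r p ≡ (if ⌊ m ℕ.≟ r ⌋ then 1 else 0)
residue-of r k m p≡3k+m m<3 = cong (λ x → if ⌊ x ℕ.≟ r ⌋ then 1 else 0) (%3-of k m p≡3k+m m<3)

PCoeff-cong : ∀ {M M′} → M ≡ M′ → ∀ a b c d → PCoeff M a b c d ≋ PCoeff M′ a b c d
PCoeff-cong refl a b c d = ≋-refl

module Period (k : ℕ) where

  private
    M₀ M₂ : ℕ
    M₀ = 3 * k + 0
    M₂ = 3 * k + 2

    1+M₀≡3k+1 : suc M₀ ≡ 3 * k + 1
    1+M₀≡3k+1 = sym (ℕₚ.+-suc (3 * k) 0)

    2+M₀≡3k+2 : 2 + M₀ ≡ 3 * k + 2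
    2+M₀≡3k+2 = trans (cong suc 1+M₀≡3k+1) (sym (ℕₚ.+-suc (3 * k) 1))

    1+M₂≡3[1+k] : suc M₂ ≡ 3 * suc k
    1+M₂≡3[1+k] = shift k
      where
      shift : ∀ k → suc (3 * k + 2) ≡ 3 * suc k
      shift = solve-∀

    1<3 : 1 < 3
    1<3 = s≤s (s≤s z≤n)

    2<3 : 2 < 3
    2<3 = s≤s (s≤s (s≤s z≤n))

    M₀%3≢1 : M₀ % 3 ≢ 1
    M₀%3≢1 M₀%3≡1 = ℕₚ.0≢1+n (trans (sym (%3-of k 0 refl (s≤s z≤n))) M₀%3≡1)

  step₁ : ∀ a b c d →
    PCoeff (3 * k + 1) (suc a) b c d ≋ PCoeff (3 * k + 0) (suc a) b c d +ₛ qpow (3 * k + 1) *ₛ PCoeff (3 * k + 0) c d a b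
  step₁ a b c d = ≋-trans (PCoeff-cong (sym 1+M₀≡3k+1) (suc a) b c d)
    (≋-trans (PCoeff-free M₀ M₀%3≢1 (suc a) b c d)
      (+ₛ-congˡ (PCoeff M₀ (suc a) b c d)
        (≋-trans (countsWithTop-≋ (DS3 M₀) (suc M₀) a b c d
                   (cong (_+ a) (residue-of 1 k 1 1+M₀≡3k+1 1<3)) (cong (_+ b) (residue-of 2 k 1 1+M₀≡3k+1 1<3)))
                 (*ₛ-congʳ (PCoeff M₀ c d a b) (qpow-cong 1+M₀≡3k+1)))))

  step₁-o₁ : ∀ b c d → PCoeff (3 * k + 1) 0 b c d ≋ PCoeff (3 * k + 0) 0 b c d
  step₁-o₁ b c d = ≋-trans (PCoeff-cong (sym 1+M₀≡3k+1) 0 b c d)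
    (≋-trans (PCoeff-free M₀ M₀%3≢1 0 b c d)
      (≋-trans (+ₛ-congˡ (PCoeff M₀ 0 b c d) (countsWithTop-vanishes (DS3 M₀) (suc M₀) 0 b c d
                 (λ n π → hasStatistics-∷-o₁ {suc M₀} b c d n π (residue-of 1 k 1 1+M₀≡3k+1 1<3))))
               (λ n → ℤₚ.+-identityʳ _)))

  step₂ : ∀ a b c d →
    PCoeff (3 * k + 2) a (suc b) c d ≋ PCoeff (3 * k + 1) a (suc b) c d +ₛ qpow (3 * k + 2) *ₛ PCoeff (3 * k + 0) c d a b
  step₂ a b c d = ≋-trans (PCoeff-cong (sym 2+M₀≡3k+2) a (suc b) c d)
    (≋-trans (PCoeff-excluding M₀ (%3-of k 1 1+M₀≡3k+1 1<3) a (suc b) c d)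
      (+ₛ-cong (PCoeff-cong 1+M₀≡3k+1 a (suc b) c d)
        (≋-trans (countsWithTop-≋ (DS3 M₀) (2 + M₀) a b c d
                   (cong (_+ a) (residue-of 1 k 2 2+M₀≡3k+2 2<3)) (cong (_+ b) (residue-of 2 k 2 2+M₀≡3k+2 2<3)))
                 (*ₛ-congʳ (PCoeff M₀ c d a b) (qpow-cong 2+M₀≡3k+2)))))

  step₂-o₂ : ∀ a c d → PCoeff (3 * k + 2) a 0 c d ≋ PCoeff (3 * k + 1) a 0 c d
  step₂-o₂ a c d = ≋-trans (PCoeff-cong (sym 2+M₀≡3k+2) a 0 c d)
    (≋-trans (PCoeff-excluding M₀ (%3-of k 1 1+M₀≡3k+1 1<3) a 0 c d)
      (≋-trans (+ₛ-cong (PCoeff-cong 1+M₀≡3k+1 a 0 c d) (countsWithTop-vanishes (DS3 M₀) (2 + M₀) a 0 c d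
                 (λ n π → hasStatistics-∷-o₂ {2 + M₀} a c d n π (residue-of 2 k 2 2+M₀≡3k+2 2<3))))
               (λ n → ℤₚ.+-identityʳ _)))

  step₃ : ∀ a b c d →
    PCoeff (3 * suc k + 0) a b c d ≋ PCoeff (3 * k + 2) a b c d +ₛ qpow (3 * suc k) *ₛ PCoeff (3 * k + 2) c d a b
  step₃ a b c d = ≋-trans (PCoeff-cong (sym (trans 1+M₂≡3[1+k] (sym (ℕₚ.+-identityʳ _)))) a b c d)
    (≋-trans (PCoeff-free M₂ (λ M₂%3≡1 → ℕₚ.1+n≢n (trans (sym (%3-of k 2 refl 2<3)) M₂%3≡1)) a b c d)
      (+ₛ-congˡ (PCoeff M₂ a b c d)
        (≋-trans (countsWithTop-≋ (DS3 M₂) (suc M₂) a b c d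
                   (cong (_+ a) (residue-of 1 (suc k) 0 (trans 1+M₂≡3[1+k] (sym (ℕₚ.+-identityʳ _))) (s≤s z≤n)))
                   (cong (_+ b) (residue-of 2 (suc k) 0 (trans 1+M₂≡3[1+k] (sym (ℕₚ.+-identityʳ _))) (s≤s z≤n))))
                 (*ₛ-congʳ (PCoeff M₂ c d a b) (qpow-cong 1+M₂≡3[1+k])))))

-- The induction on M

-- The four families [t^i u^j], [s^i v^j], [s^i u^j], [t^i v^j] of coefficients of P_M.
record ClosedForms (M : ℕ) (Xtu Xsv Xsu Xtv : ℕ → ℕ → Series) : Set where
  field
    tu : ∀ i j → PCoeff M 0 i j 0 ≋ qpow (ω 1 i j) *ₛ Xtu i j
    sv : ∀ i j → PCoeff M i 0 0 j ≋ qpow (ω 2 i j) *ₛ Xsv i j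
    su : ∀ i j → PCoeff M i 0 j 0 ≋ qpow (πe 1 i j) *ₛ Xsu i j
    tv : ∀ i j → PCoeff M 0 i 0 j ≋ qpow (πe 2 i j) *ₛ Xtv i j

open ClosedForms

Level₀ Level₁ Level₂ : ℕ → Set
Level₀ k = ClosedForms (3 * k + 0) (F k) (F k) (F k) (F k)
Level₁ k = ClosedForms (3 * k + 1) (F k) (G k) (G k) (F k)
Level₂ k = ClosedForms (3 * k + 2) (G k) (G k) (G k) (G k)

level₀-zero : Level₀ 0
level₀-zero = record
  { tu = base (λ i j → PCoeff 0 0 i j 0) (ω 1)  emptyPartition (λ i j n → refl) (λ j n → refl)
  ; sv = base (λ i j → PCoeff 0 i 0 0 j) (ω 2)  emptyPartition (λ i j n → refl) (λ j n → refl)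
  ; su = base (λ i j → PCoeff 0 i 0 j 0) (πe 1) emptyPartition (λ i j n → refl) (λ j n → refl)
  ; tv = base (λ i j → PCoeff 0 0 i 0 j) (πe 2) emptyPartition (λ i j n → refl) (λ j n → refl)
  }
  where
  emptyPartition : PCoeff 0 0 0 0 0 ≋ qpow 0 *ₛ F 0 0 0
  emptyPartition = ≋-sym (≋-trans (*ₛ-identityˡ (F 0 0 0)) (≋-trans (F-closedForm 0 0 0 refl)
    (≋-trans (solve 0 (con 1ℤ :* con 1ℤ :* con 1ℤ :* con 1ℤ :* con 1ℤ := con 1ℤ) ≋-refl) onlyEmpty)))
    where
    onlyEmpty : 1ₛ ≋ PCoeff 0 0 0 0 0
    onlyEmpty zero    = refl
    onlyEmpty (suc n) = refl

  base : ∀ (P : ℕ → ℕ → Series) (E : ℕ → ℕ → ℕ) → P 0 0 ≋ qpow (E 0 0) *ₛ F 0 0 0 →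
    (∀ i j → P (suc i) j ≋ 0ₛ) → (∀ j → P 0 (suc j) ≋ 0ₛ) → ∀ i j → P i j ≋ qpow (E i j) *ₛ F 0 i j
  base P E origin _     _     zero    zero    = origin
  base P E _      _     P₀ₛ≋0 zero    (suc j) =
    ≋-trans (P₀ₛ≋0 j) (≋-sym (*ₛ-vanishesʳ (qpow (E 0 (suc j))) (F-vanishes 0 (suc j) (s≤s z≤n))))
  base P E _      Pₛ≋0  _     (suc i) j       =
    ≋-trans (Pₛ≋0 i j) (≋-sym (*ₛ-vanishesʳ (qpow (E (suc i) j)) (F-vanishes (suc i) j (s≤s z≤n))))

module _ (k : ℕ) where
  open Period k

  level₁ : Level₀ k → Level₁ k
  level₁ L = record
    { tu = λ i j → ≋-trans (step₁-o₁ i j 0) (tu L i j)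
    ; sv = sv′
    ; su = su′
    ; tv = λ i j → ≋-trans (step₁-o₁ i 0 j) (tv L i j)
    }
    where
    sv′ : ∀ i j → PCoeff (3 * k + 1) i 0 0 j ≋ qpow (ω 2 i j) *ₛ G k i j
    sv′ zero    j = ≋-trans (step₁-o₁ 0 0 j) (≋-trans (sv L 0 j) (*ₛ-congˡ (qpow (ω 2 0 j)) (≋-sym (G-zero k j))))
    sv′ (suc i) j = ≋-trans (step₁ i 0 0 j) (≋-trans
      (+ₛ-cong (sv L (suc i) j) (*ₛ-congˡ (qpow (3 * k + 1)) (tu L j i)))
      (combine-G k i j _ _ _ (G-exponent ω₂-ω₁ 1 refl i j)))
    su′ : ∀ i j → PCoeff (3 * k + 1) i 0 j 0 ≋ qpow (πe 1 i j) *ₛ G k i j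
    su′ zero    j = ≋-trans (step₁-o₁ 0 j 0) (≋-trans (su L 0 j) (*ₛ-congˡ (qpow (πe 1 0 j)) (≋-sym (G-zero k j))))
    su′ (suc i) j = ≋-trans (step₁ i 0 j 0) (≋-trans
      (+ₛ-cong (su L (suc i) j) (*ₛ-congˡ (qpow (3 * k + 1)) (su L j i)))
      (combine-G k i j _ _ _ (G-exponent π₁-π₁ 1 refl i j)))

  level₂ : Level₀ k → Level₁ k → Level₂ k
  level₂ L₀ L₁ = record
    { tu = tu′
    ; sv = λ i j → ≋-trans (step₂-o₂ i 0 j) (sv L₁ i j)
    ; su = λ i j → ≋-trans (step₂-o₂ i j 0) (su L₁ i j)
    ; tv = tv′
    }
    where
    tu′ : ∀ i j → PCoeff (3 * k + 2) 0 i j 0 ≋ qpow (ω 1 i j) *ₛ G k i j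
    tu′ zero    j = ≋-trans (step₂-o₂ 0 j 0) (≋-trans (tu L₁ 0 j) (*ₛ-congˡ (qpow (ω 1 0 j)) (≋-sym (G-zero k j))))
    tu′ (suc i) j = ≋-trans (step₂ 0 i j 0) (≋-trans
      (+ₛ-cong (tu L₁ (suc i) j) (*ₛ-congˡ (qpow (3 * k + 2)) (sv L₀ j i)))
      (combine-G k i j _ _ _ (G-exponent ω₁-ω₂ 2 refl i j)))
    tv′ : ∀ i j → PCoeff (3 * k + 2) 0 i 0 j ≋ qpow (πe 2 i j) *ₛ G k i j
    tv′ zero    j = ≋-trans (step₂-o₂ 0 0 j) (≋-trans (tv L₁ 0 j) (*ₛ-congˡ (qpow (πe 2 0 j)) (≋-sym (G-zero k j))))
    tv′ (suc i) j = ≋-trans (step₂ 0 i 0 j) (≋-trans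
      (+ₛ-cong (tv L₁ (suc i) j) (*ₛ-congˡ (qpow (3 * k + 2)) (tv L₀ j i)))
      (combine-G k i j _ _ _ (G-exponent π₂-π₂ 2 refl i j)))

  level₃ : Level₂ k → Level₀ (suc k)
  level₃ L = record
    { tu = λ i j → ≋-trans (step₃ 0 i j 0) (≋-trans
             (+ₛ-cong (tu L i j) (*ₛ-congˡ (qpow (3 * suc k)) (sv L j i)))
             (combine-F k i j _ _ _ (F-exponent ω₁-ω₂ i j)))
    ; sv = λ i j → ≋-trans (step₃ i 0 0 j) (≋-trans
             (+ₛ-cong (sv L i j) (*ₛ-congˡ (qpow (3 * suc k)) (tu L j i)))
             (combine-F k i j _ _ _ (F-exponent ω₂-ω₁ i j)))
    ; su = λ i j → ≋-trans (step₃ i 0 j 0) (≋-trans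
             (+ₛ-cong (su L i j) (*ₛ-congˡ (qpow (3 * suc k)) (su L j i)))
             (combine-F k i j _ _ _ (F-exponent π₁-π₁ i j)))
    ; tv = λ i j → ≋-trans (step₃ 0 i 0 j) (≋-trans
             (+ₛ-cong (tv L i j) (*ₛ-congˡ (qpow (3 * suc k)) (tv L j i)))
             (combine-F k i j _ _ _ (F-exponent π₂-π₂ i j)))
    }

level₀ : ∀ k → Level₀ k
level₀ zero    = level₀-zero
level₀ (suc k) = level₃ k (level₂ k (level₀ k) (level₁ k (level₀ k)))

pickF : ∀ N i j {P e} → P ≋ qpow e *ₛ F N i j → P ≋ qpow e *ₛ (1ℤ ·ₛ F N i j +ₛ 0ℤ ·ₛ G N i j)
pickF N i j {e = e} P≋ = ≋-trans P≋ (*ₛ-congˡ (qpow e) (λ n →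
  sym (trans (cong₂ ℤ._+_ (ℤₚ.*-identityˡ (F N i j n)) (ℤₚ.*-zeroˡ (G N i j n))) (ℤₚ.+-identityʳ (F N i j n)))))

pickG : ∀ N i j {P e} → P ≋ qpow e *ₛ G N i j → P ≋ qpow e *ₛ (0ℤ ·ₛ F N i j +ₛ 1ℤ ·ₛ G N i j)
pickG N i j {e = e} P≋ = ≋-trans P≋ (*ₛ-congˡ (qpow e) (λ n →
  sym (trans (cong₂ ℤ._+_ (ℤₚ.*-zeroˡ (F N i j n)) (ℤₚ.*-identityˡ (G N i j n))) (ℤₚ.+-identityˡ (G N i j n)))))

-- The closed forms hold for all i and j.
theorem3p11 : (N i j μ : ℕ) → i ≤ N → j ≤ N → μ ≤ 2 →
    (PCoeff (3 * N + μ) 0 i j 0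
      ≋ qpow (ω 1 i j) *ₛ ((δ 0 μ +ℤ δ 1 μ) ·ₛ F N i j +ₛ δ 2 μ ·ₛ G N i j))
  × (PCoeff (3 * N + μ) i 0 0 j
      ≋ qpow (ω 2 i j) *ₛ (δ 0 μ ·ₛ F N i j +ₛ (δ 1 μ +ℤ δ 2 μ) ·ₛ G N i j))
  × (PCoeff (3 * N + μ) i 0 j 0
      ≋ qpow (πe 1 i j) *ₛ (δ 0 μ ·ₛ F N i j +ₛ (δ 1 μ +ℤ δ 2 μ) ·ₛ G N i j))
  × (PCoeff (3 * N + μ) 0 i 0 j
      ≋ qpow (πe 2 i j) *ₛ ((δ 0 μ +ℤ δ 1 μ) ·ₛ F N i j +ₛ δ 2 μ ·ₛ G N i j))
theorem3p11 N i j 0 _ _ _ =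
  pickF N i j (tu L i j) , pickF N i j (sv L i j) , pickF N i j (su L i j) , pickF N i j (tv L i j)
  where L = level₀ N
theorem3p11 N i j 1 _ _ _ =
  pickF N i j (tu L i j) , pickG N i j (sv L i j) , pickG N i j (su L i j) , pickF N i j (tv L i j)
  where L = level₁ N (level₀ N)
theorem3p11 N i j 2 _ _ _ =
  pickG N i j (tu L i j) , pickG N i j (sv L i j) , pickG N i j (su L i j) , pickG N i j (tv L i j)
  where L = level₂ N (level₀ N) (level₁ N (level₀ N))
theorem3p11 N i j (suc (suc (suc _))) _ _ (s≤s (s≤s ()))
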